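{- (i) $\vdash A$ if and only if $\vdash^* A$. (ii) A variable-free theorem of PRA* has a variable-free proof in PRA*. (iii) $\vdash^* A$ if and only if $\vdash^{\chi*}\chi A$. (iv) A variable-free theorem of $\chi$PRA* has a variable-free proof in $\chi$PRA*.
   Context: PRA (Primitive Recursive Arithmetic) is the quantifier-free formal system whose symbols are variables, PR function symbols, $=$, $\neg$, $\vee$; terms are variables and $f(a_1,\dots,a_n)$; formulas are built from equations $a=b$ by $\neg,\vee$, with $\wedge,\to,\leftrightarrow$ the usual abbreviations and $a\ne b$ for $\neg\,a=b$. $u_{\vec x}(\vec a)$ denotes substitution. A function symbol $f$ is defined by primitive recursion by $f(\vec x,0)=a$, $f(\vec x,Sy)=b_z(f(\vec x,y))$ ($\vec x,y,z$ distinct, $a$ with variables among $\vec x$, $b$ with variables among $\vec x,y,z$); PR function symbols are those obtainable from $0$ and $S$ by finitely many such definitions. Axioms of PRA: the defining equations; $\neg\,Sx=0$; $Sx=Sy\to x=y$; $x=x$; $x=y\to y=x$; $x=y\wedge A_x(x)\to A_x(y)$; $A\vee A\to A$; $A\to A\vee B$; $A\vee B\to B\vee A$; $(B\to C)\to(A\vee B\to A\vee C)$. Rules: instance, modus ponens, induction (from $A_x(0)$ and $A_x(x')\to A_x(Sx')$ infer $A_x(x)$). $\vdash$ denotes provability in PRA. Symbols: $x+0=x$, $x+Sy=S(x+y)$; $P0=0$, $PSx=x$; $x-0=x$, $x-Sy=P(x-y)$; $C(0,y,z)=y$, $C(Sx,y,z)=z$; $\mathrm{Eq}(x,y)=(x-y)+(y-x)$;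 $x\mathrel{\dot=}y=C(\mathrm{Eq}(x,y),0,S0)$; $\dot\neg x=C(x,S0,0)$; $x\mathbin{\dot\vee}y=C(x,0,C(y,0,S0))$; $x\mathbin{\dot\to}y=\dot\neg x\mathbin{\dot\vee}y$. $\chi A$ (characteristic term): replace each $=$ by $\mathrel{\dot=}$, $\neg$ by $\dot\neg$, $\vee$ by $\mathbin{\dot\vee}$. $x\le y$ abbreviates $x-y=0$. For a formula $A$ and variable $x$, with $\vec y$ the other variables of $A$, the PR symbol $\mu_A$ is defined by $\mu_A(\vec y,0)=C(\chi[A_x(0)],0,S0)$, $\mu_A(\vec y,Sx)=C(\chi[\mu_A(\vec y,x)\le x],\mu_A(\vec y,x),C(\chi[A_x(Sx)],Sx,SSx))$; write $\mu_A(a)$ for $\mu_A(\vec y,a)$. For a term $b$ not containing $x$, $\forall x{\le}b\,A$ abbreviates $A_x(\mu_{\neg A}(b))$. PRA*: same symbols, terms and formulas as PRA; its axioms are all instances of axioms of PRA and all instances of the schema $A_x(0)\wedge\forall x'{\le}Px[A_x(x')\to A_x(Sx')]\to A_x(x)$; its only rule is modus ponens; $\vdash^*$ denotes provability in PRA*. $\chi$PRA*: its formulas are the $\chi$-formulas (terms built from $a\mathrel{\dot=}b$ by $\dot\neg$ and $\mathbin{\dot\vee}$); its axioms are the characteristic terms of the axioms of PRA*; its only rule is: from $\alpha$ and $\alpha\mathbin{\dot\to}\beta$ infer $\beta$; $\vdash^{\chi*}$ denotes provability in it. -}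

module Defs where

open import Data.Nat using (ℕ; zero; suc; _≡ᵇ_; _⊔_)
open import Data.Fin using (Fin; toℕ; fromℕ; inject₁)
  renaming (zero to fzero; suc to fsuc)
open import Data.Vec using (Vec; []; _∷_; _∷ʳ_; tabulate)
  renaming (map to vmap; fromList to vfromList)
open import Data.List using (List; []; _∷_; _++_; length; upTo; filterᵇ; foldr)
open import Data.Bool.ListAction using (any)
open import Data.Maybe using (Maybe; just; nothing; maybe)
  renaming (map to mmap)
open import Data.Bool using (Bool; true; false; if_then_else_; _∧_; not)
open import Data.Product using (_×_)
open import Relation.Binary.PropositionalEquality using (_≡_; _≢_)

-- A symbol of arity (suc n) defined by primitive recursion
--   f(x₀..xₙ₋₁,0) = a,   f(x₀..xₙ₋₁,Sy) = b_z(f(x₀..xₙ₋₁,y))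
-- is  rec a b  with  a : Tm (Fin n)  (variables among x₀..xₙ₋₁, the
-- variable with index i being xᵢ) and  b : Tm (Fin (2+n))  where the
-- variable of index i < n is xᵢ, index n is y and index n+1 is z.
-- The recursion argument is the LAST argument.

data Sym : ℕ → Set
data Tm (V : Set) : Set

data Sym where
  zeroS : Sym 0
  sucS  : Sym 1
  rec   : ∀ {n} → Tm (Fin n) → Tm (Fin (suc (suc n))) → Sym (suc n)

data Tm V where
  var : V → Tm V
  app : ∀ {n} → Sym n → Vec (Tm V) n → Tm V

_⟦_⟧  : ∀ {V W : Set} → Tm V → (V → Tm W) → Tm W
_⟦_⟧* : ∀ {V W : Set} {n} → Vec (Tm V) n → (V → Tm W) → Vec (Tm W) n
var v    ⟦ σ ⟧ = σ v
app f ts ⟦ σ ⟧ = app f (ts ⟦ σ ⟧*)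
[]       ⟦ σ ⟧* = []
(t ∷ ts) ⟦ σ ⟧* = (t ⟦ σ ⟧) ∷ (ts ⟦ σ ⟧*)

varsT  : ∀ {V : Set} → Tm V → List V
varsT* : ∀ {V : Set} {n} → Vec (Tm V) n → List V
varsT (var v)    = v ∷ []
varsT (app f ts) = varsT* ts
varsT* []       = []
varsT* (t ∷ ts) = varsT t ++ varsT* ts

𝟎 : ∀ {V : Set} → Tm V
𝟎 = app zeroS []

S : ∀ {V : Set} → Tm V → Tm V
S t = app sucS (t ∷ [])

-- x + 0 = x, x + Sy = S(x+y)
plusS : Sym 2
plusS = rec (var fzero) (S (var (fsuc (fsuc fzero))))

-- P0 = 0, PSy = y
predS : Sym 1
predS = rec 𝟎 (var fzero)

-- x - 0 = x, x - Sy = P(x - y)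
monusS : Sym 2
monusS = rec (var fzero) (app predS (var (fsuc (fsuc fzero)) ∷ []))

-- C'(y,z,0) = y, C'(y,z,Sx) = z   (recursion on the last argument);
-- the paper's C(x,y,z) is C'(y,z,x).
condS : Sym 3
condS = rec (var fzero) (var (fsuc fzero))

_+ᵗ_ : ∀ {V : Set} → Tm V → Tm V → Tm V
a +ᵗ b = app plusS (a ∷ b ∷ [])

Pᵗ : ∀ {V : Set} → Tm V → Tm V
Pᵗ a = app predS (a ∷ [])

_-ᵗ_ : ∀ {V : Set} → Tm V → Tm V → Tm V
a -ᵗ b = app monusS (a ∷ b ∷ [])

C : ∀ {V : Set} → Tm V → Tm V → Tm V → Tm V
C x y z = app condS (y ∷ z ∷ x ∷ [])

Eqᵗ : ∀ {V : Set} → Tm V → Tm V → Tm V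
Eqᵗ x y = (x -ᵗ y) +ᵗ (y -ᵗ x)

_≐_ : ∀ {V : Set} → Tm V → Tm V → Tm V
x ≐ y = C (Eqᵗ x y) 𝟎 (S 𝟎)

¬̇_ : ∀ {V : Set} → Tm V → Tm V
¬̇ x = C x (S 𝟎) 𝟎

_∨̇_ : ∀ {V : Set} → Tm V → Tm V → Tm V
x ∨̇ y = C x 𝟎 (C y 𝟎 (S 𝟎))

_→̇_ : ∀ {V : Set} → Tm V → Tm V → Tm V
x →̇ y = (¬̇ x) ∨̇ y

infix  6 _==_
infixr 5 _∨_
infixr 4 _⇒_

data Fm : Set where
  _==_ : Tm ℕ → Tm ℕ → Fm
  ~_   : Fm → Fm
  _∨_  : Fm → Fm → Fm

_∧ᶠ_ : Fm → Fm → Fm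
A ∧ᶠ B = ~ ((~ A) ∨ (~ B))

_⇒_ : Fm → Fm → Fm
A ⇒ B = (~ A) ∨ B

_⇔ᶠ_ : Fm → Fm → Fm
A ⇔ᶠ B = (A ⇒ B) ∧ᶠ (B ⇒ A)

_≠_ : Tm ℕ → Tm ℕ → Fm
a ≠ b = ~ (a == b)

_≤ᶠ_ : Tm ℕ → Tm ℕ → Fm
a ≤ᶠ b = (a -ᵗ b) == 𝟎

_[_]F : Fm → (ℕ → Tm ℕ) → Fm
(a == b) [ σ ]F = (a ⟦ σ ⟧) == (b ⟦ σ ⟧)
(~ A)    [ σ ]F = ~ (A [ σ ]F)
(A ∨ B)  [ σ ]F = (A [ σ ]F) ∨ (B [ σ ]F)

_↦_ : ℕ → Tm ℕ → ℕ → Tm ℕ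
(x ↦ a) v = if v ≡ᵇ x then a else var v

_[_≔_] : Fm → ℕ → Tm ℕ → Fm
A [ x ≔ a ] = A [ x ↦ a ]F

varsF : Fm → List ℕ
varsF (a == b) = varsT a ++ varsT b
varsF (~ A)    = varsF A
varsF (A ∨ B)  = varsF A ++ varsF B

ClosedT : Tm ℕ → Set
ClosedT t = varsT t ≡ []

ClosedF : Fm → Set
ClosedF A = varsF A ≡ []

occurs : ℕ → List ℕ → Bool
occurs v vs = any (λ w → w ≡ᵇ v) vs

χ : Fm → Tm ℕ
χ (a == b) = a ≐ b
χ (~ A)    = ¬̇ χ A
χ (A ∨ B)  = χ A ∨̇ χ B

data IsχFm : Tm ℕ → Set where
  χeq  : ∀ a b → IsχFm (a ≐ b)
  χneg : ∀ {α} → IsχFm α → IsχFm (¬̇ α)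
  χor  : ∀ {α β} → IsχFm α → IsχFm β → IsχFm (α ∨̇ β)

otherVars : Fm → ℕ → List ℕ
otherVars A x =
  filterᵇ (λ v → occurs v (varsF A) ∧ not (v ≡ᵇ x))
          (upTo (suc (foldr _⊔_ 0 (varsF A))))

indexOf : (ys : List ℕ) → ℕ → Maybe (Fin (length ys))
indexOf []       v = nothing
indexOf (y ∷ ys) v = if y ≡ᵇ v then just fzero else mmap fsuc (indexOf ys v)

-- turn a named-variable term into a scoped one: x ↦ tx, yᵢ ↦ ι i
-- (other variables, which never occur in the uses below, go to 0)
scope : ∀ {W : Set} (ys : List ℕ) (x : ℕ) (tx : Tm W) (ι : Fin (length ys) → Tm W)
        → ℕ → Tm W
scope ys x tx ι v = if v ≡ᵇ x then tx else maybe ι 𝟎 (indexOf ys v)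

μSym : (A : Fm) (x : ℕ) → Sym (suc (length (otherVars A x)))
μSym A x = rec base step
  where
  ys = otherVars A x
  m  = length ys
  X Z : Tm (Fin (suc (suc m)))
  X = var (inject₁ (fromℕ m))
  Z = var (fromℕ (suc m))
  -- μ(ȳ,0) = C(χ[A_x(0)], 0, S0)
  base : Tm (Fin m)
  base = C (χ (A [ x ≔ 𝟎 ]) ⟦ scope ys x 𝟎 var ⟧) 𝟎 (S 𝟎)
  -- μ(ȳ,Sx) = C(χ[μ(ȳ,x) ≤ x], μ(ȳ,x), C(χ[A_x(Sx)], Sx, SSx))
  step : Tm (Fin (suc (suc m)))
  step = C ((Z -ᵗ X) ≐ 𝟎) Z
           (C (χ (A [ x ≔ S (var x) ]) ⟦ scope ys x X (λ i → var (inject₁ (inject₁ i))) ⟧)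
              (S X) (S (S X)))

μ : (A : Fm) (x : ℕ) → Tm ℕ → Tm ℕ
μ A x a = app (μSym A x) (vmap var (vfromList (otherVars A x)) ∷ʳ a)

∀≤ : ℕ → Tm ℕ → Fm → Fm
∀≤ x b A = A [ x ≔ μ (~ A) x b ]

vx vy : Tm ℕ
vx = var 0
vy = var 1

params : (n : ℕ) → Vec (Tm ℕ) n
params n = tabulate (λ i → var (toℕ i))

embed : ∀ {k} → Tm (Fin k) → Tm ℕ
embed t = t ⟦ (λ i → var (toℕ i)) ⟧

data AxPRA : Fm → Set where
  -- defining equations: xᵢ is variable i, y is variable n, z is variable n+1
  defEq₀ : ∀ {n} (a : Tm (Fin n)) (b : Tm (Fin (suc (suc n)))) →
           AxPRA (app (rec a b) (params n ∷ʳ 𝟎) == embed a)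
  defEqS : ∀ {n} (a : Tm (Fin n)) (b : Tm (Fin (suc (suc n)))) →
           AxPRA (app (rec a b) (params n ∷ʳ S (var n))
                  == (embed b ⟦ suc n ↦ app (rec a b) (params n ∷ʳ var n) ⟧))
  sucNotZero : AxPRA (S vx ≠ 𝟎)
  sucInj     : AxPRA ((S vx == S vy) ⇒ (vx == vy))
  eqRefl     : AxPRA (vx == vx)
  eqSym      : AxPRA ((vx == vy) ⇒ (vy == vx))
  eqSubst    : ∀ (x y : ℕ) (A : Fm) →
               AxPRA (((var x == var y) ∧ᶠ (A [ x ≔ var x ])) ⇒ (A [ x ≔ var y ]))
  contr      : ∀ A → AxPRA ((A ∨ A) ⇒ A)
  weak       : ∀ A B → AxPRA (A ⇒ (A ∨ B))
  perm       : ∀ A B → AxPRA ((A ∨ B) ⇒ (B ∨ A))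
  assocR     : ∀ A B C' → AxPRA ((B ⇒ C') ⇒ ((A ∨ B) ⇒ (A ∨ C')))

infix 3 ⊢_ ⊢*_ ⊢χ*_

data ⊢_ : Fm → Set where
  ax   : ∀ {A} → AxPRA A → ⊢ A
  inst : ∀ {A} → ⊢ A → (σ : ℕ → Tm ℕ) → ⊢ (A [ σ ]F)
  mp   : ∀ {A B} → ⊢ A → ⊢ (A ⇒ B) → ⊢ B
  ind  : ∀ {A} (x x' : ℕ) → occurs x' (varsF A) ≡ false →
         ⊢ (A [ x ≔ 𝟎 ]) →
         ⊢ ((A [ x ≔ var x' ]) ⇒ (A [ x ≔ S (var x') ])) →
         ⊢ (A [ x ≔ var x ])

indSchema : Fm → ℕ → ℕ → Fm
indSchema A x x' =
  ((A [ x ≔ 𝟎 ]) ∧ᶠ ∀≤ x' (Pᵗ (var x)) ((A [ x ≔ var x' ]) ⇒ (A [ x ≔ S (var x') ])))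
  ⇒ (A [ x ≔ var x ])

data Ax* : Fm → Set where
  praAx : ∀ {A} → AxPRA A → (σ : ℕ → Tm ℕ) → Ax* (A [ σ ]F)
  indAx : ∀ (A : Fm) (x x' : ℕ) → x' ≢ x → occurs x' (varsF A) ≡ false →
          (σ : ℕ → Tm ℕ) → Ax* (indSchema A x x' [ σ ]F)

data ⊢*_ : Fm → Set where
  ax : ∀ {A} → Ax* A → ⊢* A
  mp : ∀ {A B} → ⊢* A → ⊢* (A ⇒ B) → ⊢* B

VarFree* : ∀ {A} → ⊢* A → Set
VarFree* {A} (ax _)   = ClosedF A
VarFree* {B} (mp d e) = ClosedF B × VarFree* d × VarFree* e

data ⊢χ*_ : Tm ℕ → Set where
  ax : ∀ {A} → Ax* A → ⊢χ* (χ A)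
  mp : ∀ {α β} → IsχFm α → IsχFm β → ⊢χ* α → ⊢χ* (α →̇ β) → ⊢χ* β

VarFreeχ : ∀ {α} → ⊢χ* α → Set
VarFreeχ {α} (ax _)         = ClosedT α
VarFreeχ {β} (mp _ _ d e)   = ClosedT β × VarFreeχ d × VarFreeχ e

-- Inside PRA the characteristic term satisfies A → χA = 0 and ¬A → χA = 1 (0 codes truth),
-- so for B(x′) = A(x′) → A(Sx′) the search term t(b) = μ_{¬B}(b) can be read logically:
-- c(b) = χ[t(b) ≤ b] is 0 exactly when the search has found an x′ ≤ b refuting B.  An
-- ordinary PRA induction on b shows that either the search has succeeded and ¬B(t(b)), or
-- A(0) → A(Sb); at b = Px this yields A(x) from A(0) and B(t(Px)), which is the induction
-- schema of PRA*.  Conversely, the induction rule is an instance of the schema, and the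
-- substitution rule is admissible in PRA* because its axioms are closed under substitution.
-- Replacing every variable by 0 throughout a proof gives (ii).  Since χ is injective on
-- formulas, maps onto the χ-formulas and commutes with substitution, proofs translate along
-- χ in both directions, which gives (iii) and (iv).
module Submission where

open import Defs
open import Data.Bool using (Bool; true; false; if_then_else_; _∧_; not; T)
open import Data.Bool.Properties using (T-≡; ¬-not; ∨-zeroʳ; ∧-zeroʳ; T?)
open import Data.Fin using (Fin; toℕ; fromℕ; inject₁) renaming (zero to fzero; suc to fsuc)
open import Data.Fin.Properties using (toℕ≤pred[n])
open import Data.List using (List; []; _∷_; foldr; upTo; length)
open import Data.List.Membership.Propositional using (_∈_; _∉_)
open import Data.List.Membership.Propositional.Properties
  using (∈-++⁺ˡ; ∈-++⁺ʳ; ∈-filter⁺; ∈-filter⁻; ∈-upTo⁺)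
open import Data.List.Relation.Unary.Any using (here; there)
open import Data.Maybe using (just)
open import Data.Nat using (ℕ; zero; suc; _≡ᵇ_; _⊔_; _≤_; _≟_; z≤n; s≤s; s≤s⁻¹)
open import Data.Nat.Properties
  using (≡ᵇ⇒≡; ≡⇒≡ᵇ; m≤m⊔n; m≤n⊔m; ≤-refl; ≤-trans; n≮n; ≤∧≢⇒<)
open import Data.Product using (_×_; _,_; proj₁; proj₂; Σ)
open import Data.Unit using (tt)
open import Data.Vec using (Vec; []; _∷_; _∷ʳ_; lookup; tabulate)
  renaming (fromList to vfromList; map to vmap)
open import Data.Vec.Properties
  using (map-∷ʳ; tabulate-∘; tabulate-cong; tabulate∘lookup; lookup-map)
open import Function using (_∘_; case_of_; Equivalence)
open import Relation.Binary.PropositionalEquality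
  using (_≡_; _≢_; refl; sym; trans; cong; cong₂; subst; subst₂; module ≡-Reasoning)
open import Relation.Nullary using (¬_; yes; no)

≡ᵇ-refl : ∀ n → (n ≡ᵇ n) ≡ true
≡ᵇ-refl n = Equivalence.to T-≡ (≡⇒≡ᵇ n n refl)

≢⇒≡ᵇ≡false : ∀ {m n} → m ≢ n → (m ≡ᵇ n) ≡ false
≢⇒≡ᵇ≡false {m} {n} m≢n = ¬-not (m≢n ∘ ≡ᵇ⇒≡ m n ∘ Equivalence.from T-≡)

↦-≡ : ∀ x (a : Tm ℕ) → (x ↦ a) x ≡ a
↦-≡ x a rewrite ≡ᵇ-refl x = refl

↦-≢ : ∀ {x v} (a : Tm ℕ) → v ≢ x → (x ↦ a) v ≡ var v
↦-≢ a v≢x rewrite ≢⇒≡ᵇ≡false v≢x = refl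

_⨾_ : ∀ {U V W : Set} → (U → Tm V) → (V → Tm W) → U → Tm W
(σ ⨾ τ) u = σ u ⟦ τ ⟧

⟦⟧-cong  : ∀ {V W : Set} (t : Tm V) {σ τ : V → Tm W} →
           (∀ v → v ∈ varsT t → σ v ≡ τ v) → t ⟦ σ ⟧ ≡ t ⟦ τ ⟧
⟦⟧*-cong : ∀ {V W : Set} {n} (ts : Vec (Tm V) n) {σ τ : V → Tm W} →
           (∀ v → v ∈ varsT* ts → σ v ≡ τ v) → ts ⟦ σ ⟧* ≡ ts ⟦ τ ⟧*
⟦⟧-cong (var v)    σ≗τ = σ≗τ v (here refl)
⟦⟧-cong (app f ts) σ≗τ = cong (app f) (⟦⟧*-cong ts σ≗τ)
⟦⟧*-cong []       σ≗τ = refl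
⟦⟧*-cong (t ∷ ts) σ≗τ =
  cong₂ _∷_ (⟦⟧-cong t (λ v → σ≗τ v ∘ ∈-++⁺ˡ)) (⟦⟧*-cong ts (λ v → σ≗τ v ∘ ∈-++⁺ʳ (varsT t)))

⟦⟧-⟦⟧  : ∀ {U V W : Set} (t : Tm U) (σ : U → Tm V) (τ : V → Tm W) →
         t ⟦ σ ⟧ ⟦ τ ⟧ ≡ t ⟦ σ ⨾ τ ⟧
⟦⟧*-⟦⟧ : ∀ {U V W : Set} {n} (ts : Vec (Tm U) n) (σ : U → Tm V) (τ : V → Tm W) →
         ts ⟦ σ ⟧* ⟦ τ ⟧* ≡ ts ⟦ σ ⨾ τ ⟧*
⟦⟧-⟦⟧ (var v)    σ τ = refl
⟦⟧-⟦⟧ (app f ts) σ τ = cong (app f) (⟦⟧*-⟦⟧ ts σ τ)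
⟦⟧*-⟦⟧ []       σ τ = refl
⟦⟧*-⟦⟧ (t ∷ ts) σ τ = cong₂ _∷_ (⟦⟧-⟦⟧ t σ τ) (⟦⟧*-⟦⟧ ts σ τ)

⟦var⟧  : ∀ {V : Set} (t : Tm V) → t ⟦ var ⟧ ≡ t
⟦var⟧* : ∀ {V : Set} {n} (ts : Vec (Tm V) n) → ts ⟦ var ⟧* ≡ ts
⟦var⟧ (var v)    = refl
⟦var⟧ (app f ts) = cong (app f) (⟦var⟧* ts)
⟦var⟧* []       = refl
⟦var⟧* (t ∷ ts) = cong₂ _∷_ (⟦var⟧ t) (⟦var⟧* ts)

⟦⟧*-map : ∀ {V W : Set} {n} (ts : Vec (Tm V) n) (σ : V → Tm W) → ts ⟦ σ ⟧* ≡ vmap (_⟦ σ ⟧) ts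
⟦⟧*-map []       σ = refl
⟦⟧*-map (t ∷ ts) σ = cong (t ⟦ σ ⟧ ∷_) (⟦⟧*-map ts σ)

[]F-cong : ∀ (A : Fm) {σ τ : ℕ → Tm ℕ} →
           (∀ v → v ∈ varsF A → σ v ≡ τ v) → A [ σ ]F ≡ A [ τ ]F
[]F-cong (a == b) σ≗τ =
  cong₂ _==_ (⟦⟧-cong a (λ v → σ≗τ v ∘ ∈-++⁺ˡ)) (⟦⟧-cong b (λ v → σ≗τ v ∘ ∈-++⁺ʳ (varsT a)))
[]F-cong (~ A)    σ≗τ = cong ~_ ([]F-cong A σ≗τ)
[]F-cong (A ∨ B)  σ≗τ =
  cong₂ _∨_ ([]F-cong A (λ v → σ≗τ v ∘ ∈-++⁺ˡ)) ([]F-cong B (λ v → σ≗τ v ∘ ∈-++⁺ʳ (varsF A)))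

[]F-[]F : ∀ (A : Fm) (σ τ : ℕ → Tm ℕ) → A [ σ ]F [ τ ]F ≡ A [ σ ⨾ τ ]F
[]F-[]F (a == b) σ τ = cong₂ _==_ (⟦⟧-⟦⟧ a σ τ) (⟦⟧-⟦⟧ b σ τ)
[]F-[]F (~ A)    σ τ = cong ~_ ([]F-[]F A σ τ)
[]F-[]F (A ∨ B)  σ τ = cong₂ _∨_ ([]F-[]F A σ τ) ([]F-[]F B σ τ)

[var]F : ∀ (A : Fm) → A [ var ]F ≡ A
[var]F (a == b) = cong₂ _==_ (⟦var⟧ a) (⟦var⟧ b)
[var]F (~ A)    = cong ~_ ([var]F A)
[var]F (A ∨ B)  = cong₂ _∨_ ([var]F A) ([var]F B)

χ-[]F : ∀ (A : Fm) (σ : ℕ → Tm ℕ) → χ (A [ σ ]F) ≡ χ A ⟦ σ ⟧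
χ-[]F (a == b) σ = refl
χ-[]F (~ A)    σ = cong ¬̇_ (χ-[]F A σ)
χ-[]F (A ∨ B)  σ = cong₂ _∨̇_ (χ-[]F A σ) (χ-[]F B σ)

χ-⟦⟧-cong : ∀ (A : Fm) {σ τ : ℕ → Tm ℕ} →
            (∀ v → v ∈ varsF A → σ v ≡ τ v) → χ A ⟦ σ ⟧ ≡ χ A ⟦ τ ⟧
χ-⟦⟧-cong A {σ} {τ} σ≗τ = begin
  χ A ⟦ σ ⟧     ≡⟨ χ-[]F A σ ⟨
  χ (A [ σ ]F)  ≡⟨ cong χ ([]F-cong A σ≗τ) ⟩
  χ (A [ τ ]F)  ≡⟨ χ-[]F A τ ⟩
  χ A ⟦ τ ⟧     ∎
  where open ≡-Reasoning

⟦↦⟧-⟦↦⟧ : ∀ (t : Tm ℕ) x (s u : Tm ℕ) → t ⟦ x ↦ s ⟧ ⟦ x ↦ u ⟧ ≡ t ⟦ x ↦ (s ⟦ x ↦ u ⟧) ⟧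
⟦↦⟧-⟦↦⟧ t x s u = trans (⟦⟧-⟦⟧ t (x ↦ s) (x ↦ u)) (⟦⟧-cong t pointwise)
  where
  pointwise : ∀ w → w ∈ varsT t → ((x ↦ s) ⨾ (x ↦ u)) w ≡ (x ↦ (s ⟦ x ↦ u ⟧)) w
  pointwise w _ with w ≡ᵇ x in w≡ᵇx
  ... | true  = refl
  ... | false rewrite w≡ᵇx = refl

≔-≔-absent : ∀ (A : Fm) x x′ (s u : Tm ℕ) → (∀ w → w ∈ varsF A → w ≢ x′) →
             A [ x ≔ s ] [ x′ ≔ u ] ≡ A [ x ≔ (s ⟦ x′ ↦ u ⟧) ]
≔-≔-absent A x x′ s u x′∉A = trans ([]F-[]F A (x ↦ s) (x′ ↦ u)) ([]F-cong A pointwise)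
  where
  pointwise : ∀ w → w ∈ varsF A → ((x ↦ s) ⨾ (x′ ↦ u)) w ≡ (x ↦ (s ⟦ x′ ↦ u ⟧)) w
  pointwise w w∈A with w ≡ᵇ x
  ... | true  = refl
  ... | false = ↦-≢ u (x′∉A w w∈A)

-- Hilbert systems

record HilbertSystem (P : Fm → Set) : Set where
  field
    contraction : ∀ A → P ((A ∨ A) ⇒ A)
    expansion   : ∀ A B → P (A ⇒ (A ∨ B))
    permutation : ∀ A B → P ((A ∨ B) ⇒ (B ∨ A))
    summation   : ∀ A B C → P ((B ⇒ C) ⇒ ((A ∨ B) ⇒ (A ∨ C)))
    detach      : ∀ {A B} → P A → P (A ⇒ B) → P B

module Propositional {P : Fm → Set} (hs : HilbertSystem P) where
  open HilbertSystem hs public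

  ∨-mapʳ : ∀ {A B C} → P (B ⇒ C) → P ((A ∨ B) ⇒ (A ∨ C))
  ∨-mapʳ {A} {B} {C} d = detach d (summation A B C)

  ⇒-trans : ∀ {A B C} → P (A ⇒ B) → P (B ⇒ C) → P (A ⇒ C)
  ⇒-trans {A} d e = detach d (∨-mapʳ {~ A} e)

  ⇒-refl : ∀ {A} → P (A ⇒ A)
  ⇒-refl {A} = ⇒-trans (expansion A A) (contraction A)

  ∨-comm : ∀ {A B} → P (A ∨ B) → P (B ∨ A)
  ∨-comm {A} {B} d = detach d (permutation A B)

  excluded-middle : ∀ {A} → P (A ∨ ~ A)
  excluded-middle {A} = ∨-comm ⇒-refl

  ¬¬-intro : ∀ {A} → P (A ⇒ ~ ~ A)
  ¬¬-intro {A} = excluded-middle {~ A}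

  ¬¬-elim : ∀ {A} → P (~ ~ A ⇒ A)
  ¬¬-elim {A} = ∨-comm (detach excluded-middle (∨-mapʳ {A} (¬¬-intro {~ A})))

  expansionʳ : ∀ {A B} → P (B ⇒ (A ∨ B))
  expansionʳ {A} {B} = ⇒-trans (expansion B A) (permutation B A)

  ∨-introˡ : ∀ {A B} → P A → P (A ∨ B)
  ∨-introˡ {A} {B} d = detach d (expansion A B)

  ∨-introʳ : ∀ {A B} → P B → P (A ∨ B)
  ∨-introʳ d = detach d expansionʳ

  ∨-elim⇒ : ∀ {A B C} → P (A ⇒ C) → P (B ⇒ C) → P ((A ∨ B) ⇒ C)
  ∨-elim⇒ {A} {B} {C} d e =
    ⇒-trans (∨-mapʳ {A} e) (⇒-trans (permutation A C) (⇒-trans (∨-mapʳ {C} d) (contraction C)))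

  ∨-elim : ∀ {A B C} → P (A ∨ B) → P (A ⇒ C) → P (B ⇒ C) → P C
  ∨-elim d e f = detach d (∨-elim⇒ e f)

  weaken : ∀ {A X} → P X → P (A ⇒ X)
  weaken {A} {X} d = detach d (⇒-trans (expansion X (~ A)) (permutation X (~ A)))

  ⇒-detach : ∀ {A B C} → P (A ⇒ B) → P (A ⇒ (B ⇒ C)) → P (A ⇒ C)
  ⇒-detach {A} {B} {C} d e = detach (detach d (∨-mapʳ {~ A} (detach e exchange))) contract
    where
    exchange : ∀ {D E F} → P ((D ∨ (E ∨ F)) ⇒ (E ∨ (D ∨ F)))
    exchange {D} {E} {F} = ∨-elim⇒ (⇒-trans (expansion D F) expansionʳ) (∨-mapʳ expansionʳ)
    contract : ∀ {D F} → P ((D ∨ (D ∨ F)) ⇒ (D ∨ F))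
    contract {D} {F} = ∨-elim⇒ (expansion D F) ⇒-refl

  explosion : ∀ {A B} → P A → P (~ A) → P B
  explosion {A} {B} a ¬a = detach a (detach ¬a (expansion (~ A) B))

  vacuous : ∀ {A C} → P A → P (~ A ⇒ C)
  vacuous {A} {C} a = ∨-introˡ (detach a ¬¬-intro)

  vacuous¬ : ∀ {A C} → P (~ A) → P (A ⇒ C)
  vacuous¬ = ∨-introˡ

  by-cases : ∀ {A C} → P (A ⇒ C) → P (~ A ⇒ C) → P C
  by-cases = ∨-elim excluded-middle

  ∧-intro : ∀ {A B} → P A → P B → P (A ∧ᶠ B)
  ∧-intro a b = by-cases (∨-elim⇒ (vacuous a) (vacuous b)) ⇒-refl

  contraposition : ∀ {A B} → P (A ⇒ B) → P (~ B ⇒ ~ A)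
  contraposition d = ∨-comm (detach d (∨-mapʳ ¬¬-intro))

  ∧-elimˡ : ∀ {A B} → P (A ∧ᶠ B) → P A
  ∧-elimˡ {A} {B} d = detach d (⇒-trans (contraposition (expansion (~ A) (~ B))) ¬¬-elim)

  ∧-elimʳ : ∀ {A B} → P (A ∧ᶠ B) → P B
  ∧-elimʳ {A} {B} d = detach d (⇒-trans (contraposition (expansionʳ {~ A} {~ B})) ¬¬-elim)

  modus-tollens : ∀ {A B} → P (A ⇒ B) → P (~ B) → P (~ A)
  modus-tollens d ¬b = detach ¬b (contraposition d)

  ¬∨-elimˡ : ∀ {A B} → P (~ (A ∨ B)) → P (~ A)
  ¬∨-elimˡ {A} {B} = modus-tollens (expansion A B)

  ¬∨-elimʳ : ∀ {A B} → P (~ (A ∨ B)) → P (~ B)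
  ¬∨-elimʳ {A} {B} = modus-tollens (expansionʳ {A} {B})

  curry : ∀ {A B C} → P ((A ∧ᶠ B) ⇒ C) → P (A ⇒ (B ⇒ C))
  curry {A} {B} {C} d = detach d reassociate
    where
    reassociate : P ((~ ~ (~ A ∨ ~ B) ∨ C) ⇒ (~ A ∨ (~ B ∨ C)))
    reassociate = ∨-elim⇒ (⇒-trans ¬¬-elim (∨-elim⇒ (expansion (~ A) (~ B ∨ C))
                                                   (⇒-trans (expansion (~ B) C) expansionʳ)))
                          (⇒-trans expansionʳ expansionʳ)

-- A form of the deduction theorem.
⇒-hilbert : ∀ {P} → HilbertSystem P → (H : Fm) → HilbertSystem (λ X → P (H ⇒ X))
⇒-hilbert hs H = record
  { contraction = λ A → weaken (contraction A)
  ; expansion   = λ A B → weaken (expansion A B)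
  ; permutation = λ A B → weaken (permutation A B)
  ; summation   = λ A B C → weaken (summation A B C)
  ; detach      = ⇒-detach }
  where open Propositional hs

record Theory (P : Fm → Set) : Set where
  field
    hilbert : HilbertSystem P
    lift    : ∀ {X} → ⊢ X → P X

pra : Theory ⊢_
pra = record
  { hilbert = record
    { contraction = λ A → ax (contr A)
    ; expansion   = λ A B → ax (weak A B)
    ; permutation = λ A B → ax (perm A B)
    ; summation   = λ A B C → ax (assocR A B C)
    ; detach      = mp }
  ; lift = λ d → d }

assuming : ∀ {P} → Theory P → (H : Fm) → Theory (λ X → P (H ⇒ X))
assuming T H = record
  { hilbert = ⇒-hilbert (Theory.hilbert T) H
  ; lift    = Propositional.weaken (Theory.hilbert T) ∘ Theory.lift T }

listSub : List (Tm ℕ) → ℕ → Tm ℕ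
listSub []       v       = 𝟎
listSub (a ∷ as) zero    = a
listSub (a ∷ as) (suc v) = listSub as v

v₀ v₁ v₂ v₃ v₄ : Tm ℕ
v₀ = var 0
v₁ = var 1
v₂ = var 2
v₃ = var 3
v₄ = var 4

𝟏 : ∀ {V : Set} → Tm V
𝟏 = S 𝟎

inst₁ : ∀ {A} → ⊢ A → (a : Tm ℕ) → ⊢ (A [ listSub (a ∷ []) ]F)
inst₁ d a = inst d (listSub (a ∷ []))

inst₂ : ∀ {A} → ⊢ A → (a b : Tm ℕ) → ⊢ (A [ listSub (a ∷ b ∷ []) ]F)
inst₂ d a b = inst d (listSub (a ∷ b ∷ []))

inst₃ : ∀ {A} → ⊢ A → (a b c : Tm ℕ) → ⊢ (A [ listSub (a ∷ b ∷ c ∷ []) ]F)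
inst₃ d a b c = inst d (listSub (a ∷ b ∷ c ∷ []))

module Reasoning {P : Fm → Set} (T : Theory P) where
  open Theory T public
  open Propositional hilbert public

  -- hyp {H} proves the hypothesis H in the theory assuming T H.
  hyp : ∀ {H} → P (H ⇒ H)
  hyp = ⇒-refl

  -- The substitution axiom for variables 0 and 1 under an instance σ.  In the congruences
  -- below, variable 2 of A is a second copy of a, so that A [ 0 ≔ v₀ ] [ σ ]F is a = a.
  replace : (A : Fm) (σ : ℕ → Tm ℕ) →
            P ((v₀ == v₁) [ σ ]F) → P (A [ 0 ≔ v₀ ] [ σ ]F) → P (A [ 0 ≔ v₁ ] [ σ ]F)
  replace A σ e d = detach d (detach e (lift (inst (Propositional.curry (Theory.hilbert pra)
                                                    (ax (eqSubst 0 1 A))) σ)))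

  ==-refl : (a : Tm ℕ) → P (a == a)
  ==-refl a = lift (inst₁ (ax eqRefl) a)

  ==-sym : ∀ {a b} → P (a == b) → P (b == a)
  ==-sym {a} {b} e = detach e (lift (inst₂ (ax eqSym) a b))

  ==-trans : ∀ {a b c} → P (a == b) → P (b == c) → P (a == c)
  ==-trans {a} {b} {c} e f = replace (v₂ == v₀) (listSub (b ∷ c ∷ a ∷ [])) f e

  infixl 5 _∙_
  _∙_ : ∀ {a b c} → P (a == b) → P (b == c) → P (a == c)
  _∙_ = ==-trans

  S-cong : ∀ {a b} → P (a == b) → P (S a == S b)
  S-cong {a} {b} e = replace (S v₂ == S v₀) (listSub (a ∷ b ∷ a ∷ [])) e (==-refl (S a))

  P-cong : ∀ {a b} → P (a == b) → P (Pᵗ a == Pᵗ b)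
  P-cong {a} {b} e = replace (Pᵗ v₂ == Pᵗ v₀) (listSub (a ∷ b ∷ a ∷ [])) e (==-refl (Pᵗ a))

  monus-congˡ : ∀ {a b} c → P (a == b) → P ((a -ᵗ c) == (b -ᵗ c))
  monus-congˡ {a} {b} c e =
    replace ((v₂ -ᵗ v₃) == (v₀ -ᵗ v₃)) (listSub (a ∷ b ∷ a ∷ c ∷ [])) e (==-refl (a -ᵗ c))

  monus-congʳ : ∀ {a b} c → P (a == b) → P ((c -ᵗ a) == (c -ᵗ b))
  monus-congʳ {a} {b} c e =
    replace ((v₃ -ᵗ v₂) == (v₃ -ᵗ v₀)) (listSub (a ∷ b ∷ a ∷ c ∷ [])) e (==-refl (c -ᵗ a))

  plus-congˡ : ∀ {a b} c → P (a == b) → P ((a +ᵗ c) == (b +ᵗ c))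
  plus-congˡ {a} {b} c e =
    replace ((v₂ +ᵗ v₃) == (v₀ +ᵗ v₃)) (listSub (a ∷ b ∷ a ∷ c ∷ [])) e (==-refl (a +ᵗ c))

  plus-congʳ : ∀ {a b} c → P (a == b) → P ((c +ᵗ a) == (c +ᵗ b))
  plus-congʳ {a} {b} c e =
    replace ((v₃ +ᵗ v₂) == (v₃ +ᵗ v₀)) (listSub (a ∷ b ∷ a ∷ c ∷ [])) e (==-refl (c +ᵗ a))

  C-cong₁ : ∀ {a b} y z → P (a == b) → P (C a y z == C b y z)
  C-cong₁ {a} {b} y z e =
    replace (C v₂ v₃ v₄ == C v₀ v₃ v₄) (listSub (a ∷ b ∷ a ∷ y ∷ z ∷ [])) e (==-refl (C a y z))

  C-cong₃ : ∀ {a b} x y → P (a == b) → P (C x y a == C x y b)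
  C-cong₃ {a} {b} x y e =
    replace (C v₃ v₄ v₂ == C v₃ v₄ v₀) (listSub (a ∷ b ∷ a ∷ x ∷ y ∷ [])) e (==-refl (C x y a))

  S≠0 : ∀ a → P (S a ≠ 𝟎)
  S≠0 a = lift (inst₁ (ax sucNotZero) a)

  plus-zero : ∀ a → P ((a +ᵗ 𝟎) == a)
  plus-zero a = lift (inst₁ (ax (defEq₀ _ _)) a)

  plus-suc : ∀ a b → P ((a +ᵗ S b) == S (a +ᵗ b))
  plus-suc a b = lift (inst₂ (ax (defEqS _ _)) a b)

  P-zero : P (Pᵗ 𝟎 == 𝟎)
  P-zero = lift (ax (defEq₀ _ _))

  P-suc : ∀ a → P (Pᵗ (S a) == a)
  P-suc a = lift (inst₁ (ax (defEqS _ _)) a)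

  monus-zero : ∀ a → P ((a -ᵗ 𝟎) == a)
  monus-zero a = lift (inst₁ (ax (defEq₀ _ _)) a)

  monus-suc : ∀ a b → P ((a -ᵗ S b) == Pᵗ (a -ᵗ b))
  monus-suc a b = lift (inst₂ (ax (defEqS _ _)) a b)

  C-zero : ∀ y z → P (C 𝟎 y z == y)
  C-zero y z = lift (inst₂ (ax (defEq₀ _ _)) y z)

  C-suc : ∀ x y z → P (C (S x) y z == z)
  C-suc x y z = lift (inst₃ (ax (defEqS _ _)) y z x)

  zero-suc-absurd : ∀ {a b X} → P (a == 𝟎) → P (a == S b) → P X
  zero-suc-absurd {a} {b} e f = explosion (==-sym f ∙ e) (S≠0 b)

-- Arithmetic in PRA

zero-or-suc : ⊢ ((v₀ == 𝟎) ∨ (v₀ == S (Pᵗ v₀)))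
zero-or-suc = ind {A = (v₀ == 𝟎) ∨ (v₀ == S (Pᵗ v₀))} 0 1 refl
                  (∨-introˡ (==-refl 𝟎)) (weaken (∨-introʳ (==-sym (S-cong (P-suc v₁)))))
  where open Reasoning pra

case-zero-suc : ∀ {P} (T : Theory P) (a : Tm ℕ) {X} →
                P ((a == 𝟎) ⇒ X) → P ((a == S (Pᵗ a)) ⇒ X) → P X
case-zero-suc T a = ∨-elim (lift (inst₁ zero-or-suc a))
  where open Reasoning T

C-=0 : ∀ {P} (T : Theory P) {a} y z → P (a == 𝟎) → P (C a y z == y)
C-=0 T y z a=0 = C-cong₁ y z a=0 ∙ C-zero y z
  where open Reasoning T

C-≠0 : ∀ {P} (T : Theory P) {a} y z → P (a ≠ 𝟎) → P (C a y z == z)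
C-≠0 T {a} y z a≠0 = case-zero-suc T a (U.explosion hyp (weaken a≠0))
                                       (V.C-cong₁ y z hyp V.∙ V.C-suc (Pᵗ a) y z)
  where
  open Reasoning T
  module U = Reasoning (assuming T (a == 𝟎))
  module V = Reasoning (assuming T (a == S (Pᵗ a)))

monus-zeroˡ : ⊢ ((𝟎 -ᵗ v₀) == 𝟎)
monus-zeroˡ = ind {A = (𝟎 -ᵗ v₀) == 𝟎} 0 1 refl (monus-zero 𝟎) step
  where
  open Reasoning pra
  module U = Reasoning (assuming pra ((𝟎 -ᵗ v₁) == 𝟎))
  step : ⊢ (((𝟎 -ᵗ v₁) == 𝟎) ⇒ ((𝟎 -ᵗ S v₁) == 𝟎))
  step = U.monus-suc 𝟎 v₁ U.∙ U.P-cong hyp U.∙ U.P-zero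

monus-S-S : ⊢ ((S v₀ -ᵗ S v₁) == (v₀ -ᵗ v₁))
monus-S-S = ind {A = (S v₀ -ᵗ S v₁) == (v₀ -ᵗ v₁)} 1 2 refl base step
  where
  open Reasoning pra
  module U = Reasoning (assuming pra ((S v₀ -ᵗ S v₂) == (v₀ -ᵗ v₂)))
  base : ⊢ ((S v₀ -ᵗ S 𝟎) == (v₀ -ᵗ 𝟎))
  base = monus-suc (S v₀) 𝟎 ∙ P-cong (monus-zero (S v₀)) ∙ P-suc v₀ ∙ ==-sym (monus-zero v₀)
  step : ⊢ (((S v₀ -ᵗ S v₂) == (v₀ -ᵗ v₂)) ⇒ ((S v₀ -ᵗ S (S v₂)) == (v₀ -ᵗ S v₂)))
  step = U.monus-suc (S v₀) (S v₂) U.∙ U.P-cong hyp U.∙ U.==-sym (U.monus-suc v₀ v₂)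

monus-self : ⊢ ((v₀ -ᵗ v₀) == 𝟎)
monus-self = ind {A = (v₀ -ᵗ v₀) == 𝟎} 0 1 refl (monus-zero 𝟎) step
  where
  open Reasoning pra
  module U = Reasoning (assuming pra ((v₁ -ᵗ v₁) == 𝟎))
  step : ⊢ (((v₁ -ᵗ v₁) == 𝟎) ⇒ ((S v₁ -ᵗ S v₁) == 𝟎))
  step = U.lift (inst₂ monus-S-S v₁ v₁) U.∙ hyp

monus-S-self : ⊢ ((S v₀ -ᵗ v₀) == 𝟏)
monus-S-self = ind {A = (S v₀ -ᵗ v₀) == 𝟏} 0 1 refl (monus-zero 𝟏) step
  where
  open Reasoning pra
  module U = Reasoning (assuming pra ((S v₁ -ᵗ v₁) == 𝟏))
  step : ⊢ (((S v₁ -ᵗ v₁) == 𝟏) ⇒ ((S (S v₁) -ᵗ S v₁) == 𝟏))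
  step = U.lift (inst₂ monus-S-S (S v₁) v₁) U.∙ hyp

plus-zeroˡ : ⊢ ((𝟎 +ᵗ v₀) == v₀)
plus-zeroˡ = ind {A = (𝟎 +ᵗ v₀) == v₀} 0 1 refl (plus-zero 𝟎) step
  where
  open Reasoning pra
  module U = Reasoning (assuming pra ((𝟎 +ᵗ v₁) == v₁))
  step : ⊢ (((𝟎 +ᵗ v₁) == v₁) ⇒ ((𝟎 +ᵗ S v₁) == S v₁))
  step = U.plus-suc 𝟎 v₁ U.∙ U.S-cong hyp

plus-sucˡ : ⊢ ((S v₀ +ᵗ v₁) == S (v₀ +ᵗ v₁))
plus-sucˡ = ind {A = (S v₀ +ᵗ v₁) == S (v₀ +ᵗ v₁)} 1 2 refl base step
  where
  open Reasoning pra
  module U = Reasoning (assuming pra ((S v₀ +ᵗ v₂) == S (v₀ +ᵗ v₂)))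
  base : ⊢ ((S v₀ +ᵗ 𝟎) == S (v₀ +ᵗ 𝟎))
  base = plus-zero (S v₀) ∙ S-cong (==-sym (plus-zero v₀))
  step : ⊢ (((S v₀ +ᵗ v₂) == S (v₀ +ᵗ v₂)) ⇒ ((S v₀ +ᵗ S v₂) == S (v₀ +ᵗ S v₂)))
  step = U.plus-suc (S v₀) v₂ U.∙ U.S-cong hyp U.∙ U.S-cong (U.==-sym (U.plus-suc v₀ v₂))

monus-monus : ⊢ (((v₀ -ᵗ v₁) -ᵗ v₂) == (v₀ -ᵗ (v₁ +ᵗ v₂)))
monus-monus = ind {A = ((v₀ -ᵗ v₁) -ᵗ v₂) == (v₀ -ᵗ (v₁ +ᵗ v₂))} 2 3 refl base step
  where
  open Reasoning pra
  module U = Reasoning (assuming pra (((v₀ -ᵗ v₁) -ᵗ v₃) == (v₀ -ᵗ (v₁ +ᵗ v₃))))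
  base : ⊢ (((v₀ -ᵗ v₁) -ᵗ 𝟎) == (v₀ -ᵗ (v₁ +ᵗ 𝟎)))
  base = monus-zero (v₀ -ᵗ v₁) ∙ monus-congʳ v₀ (==-sym (plus-zero v₁))
  step : ⊢ ((((v₀ -ᵗ v₁) -ᵗ v₃) == (v₀ -ᵗ (v₁ +ᵗ v₃)))
            ⇒ (((v₀ -ᵗ v₁) -ᵗ S v₃) == (v₀ -ᵗ (v₁ +ᵗ S v₃))))
  step = U.monus-suc (v₀ -ᵗ v₁) v₃ U.∙ U.P-cong hyp U.∙ U.==-sym (U.monus-suc v₀ (v₁ +ᵗ v₃))
         U.∙ U.monus-congʳ v₀ (U.==-sym (U.plus-suc v₁ v₃))

monus-plusˡ : ⊢ ((v₀ -ᵗ (v₀ +ᵗ v₁)) == 𝟎)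
monus-plusˡ = ==-sym (inst₃ monus-monus v₀ v₀ v₁) ∙ monus-congˡ v₁ monus-self ∙ inst₁ monus-zeroˡ v₁
  where open Reasoning pra

monus-plusʳ : ⊢ ((v₁ -ᵗ (v₀ +ᵗ v₁)) == 𝟎)
monus-plusʳ = ind {A = (v₁ -ᵗ (v₀ +ᵗ v₁)) == 𝟎} 0 2 refl base step
  where
  open Reasoning pra
  module U = Reasoning (assuming pra ((v₁ -ᵗ (v₂ +ᵗ v₁)) == 𝟎))
  base : ⊢ ((v₁ -ᵗ (𝟎 +ᵗ v₁)) == 𝟎)
  base = monus-congʳ v₁ (inst₁ plus-zeroˡ v₁) ∙ inst₁ monus-self v₁
  step : ⊢ (((v₁ -ᵗ (v₂ +ᵗ v₁)) == 𝟎) ⇒ ((v₁ -ᵗ (S v₂ +ᵗ v₁)) == 𝟎))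
  step = U.monus-congʳ v₁ (U.lift (inst₂ plus-sucˡ v₂ v₁)) U.∙ U.monus-suc v₁ (v₂ +ᵗ v₁)
         U.∙ U.P-cong hyp U.∙ U.P-zero

plus==𝟎ʳ : ⊢ (((v₀ +ᵗ v₁) == 𝟎) ⇒ (v₁ == 𝟎))
plus==𝟎ʳ = case-zero-suc T₁ v₁ U.hyp (V.zero-suc-absurd (U.weaken (Reasoning.hyp pra)) sum=S)
  where
  T₁ : Theory (λ X → ⊢ (((v₀ +ᵗ v₁) == 𝟎) ⇒ X))
  T₁ = assuming pra ((v₀ +ᵗ v₁) == 𝟎)
  module U = Reasoning T₁
  module V = Reasoning (assuming T₁ (v₁ == S (Pᵗ v₁)))
  sum=S : ⊢ (((v₀ +ᵗ v₁) == 𝟎) ⇒ ((v₁ == S (Pᵗ v₁)) ⇒ ((v₀ +ᵗ v₁) == S (v₀ +ᵗ Pᵗ v₁))))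
  sum=S = V.plus-congʳ v₀ U.hyp V.∙ V.plus-suc v₀ (Pᵗ v₁)

plus==𝟎ˡ : ⊢ (((v₀ +ᵗ v₁) == 𝟎) ⇒ (v₀ == 𝟎))
plus==𝟎ˡ = U.==-sym (U.plus-zero v₀) U.∙ U.plus-congʳ v₀ (U.==-sym v₁=0) U.∙ hyp
  where
  open Reasoning pra
  module U = Reasoning (assuming pra ((v₀ +ᵗ v₁) == 𝟎))
  v₁=0 : ⊢ (((v₀ +ᵗ v₁) == 𝟎) ⇒ (v₁ == 𝟎))
  v₁=0 = plus==𝟎ʳ

Antisymmetric : Tm ℕ → Tm ℕ → Fm
Antisymmetric a b = ((a -ᵗ b) == 𝟎) ⇒ (((b -ᵗ a) == 𝟎) ⇒ (a == b))

Antisymmetric-cong : ∀ {P} (T : Theory P) {a a′ b b′} →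
                     P (a == a′) → P (b == b′) → P (Antisymmetric a b) → P (Antisymmetric a′ b′)
Antisymmetric-cong {P} T {a} {a′} {b} {b′} a=a′ b=b′ antisym =
  W₂.==-sym (up a=a′) W₂.∙ W₂.detach b-a=0 (W₂.detach a-b=0 (up antisym)) W₂.∙ up b=b′
  where
  T₁ : Theory (λ X → P (((a′ -ᵗ b′) == 𝟎) ⇒ X))
  T₁ = assuming T ((a′ -ᵗ b′) == 𝟎)
  T₂ : Theory (λ X → P (((a′ -ᵗ b′) == 𝟎) ⇒ (((b′ -ᵗ a′) == 𝟎) ⇒ X)))
  T₂ = assuming T₁ ((b′ -ᵗ a′) == 𝟎)
  module W₀ = Reasoning T
  module W₁ = Reasoning T₁
  module W₂ = Reasoning T₂
  up : ∀ {X} → P X → P (((a′ -ᵗ b′) == 𝟎) ⇒ (((b′ -ᵗ a′) == 𝟎) ⇒ X))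
  up = W₁.weaken ∘ W₀.weaken
  a-b=0 : P (((a′ -ᵗ b′) == 𝟎) ⇒ (((b′ -ᵗ a′) == 𝟎) ⇒ ((a -ᵗ b) == 𝟎)))
  a-b=0 = W₂.monus-congˡ b (up a=a′) W₂.∙ W₂.monus-congʳ a′ (up b=b′) W₂.∙ W₁.weaken W₀.hyp
  b-a=0 : P (((a′ -ᵗ b′) == 𝟎) ⇒ (((b′ -ᵗ a′) == 𝟎) ⇒ ((b -ᵗ a) == 𝟎)))
  b-a=0 = W₂.monus-congˡ a (up b=b′) W₂.∙ W₂.monus-congʳ b′ (up a=a′) W₂.∙ W₁.hyp

Antisymmetric-P : ⊢ (Antisymmetric (Pᵗ v₀) (Pᵗ v₁) ⇒ Antisymmetric v₀ v₁)
Antisymmetric-P = case-zero-suc T₃ v₀ v₀=0 v₀=S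
  where
  H₁ H₂ H₃ : Fm
  H₁ = Antisymmetric (Pᵗ v₀) (Pᵗ v₁)
  H₂ = (v₀ -ᵗ v₁) == 𝟎
  H₃ = (v₁ -ᵗ v₀) == 𝟎
  ⊢₃ : Fm → Set
  ⊢₃ X = ⊢ (H₁ ⇒ (H₂ ⇒ (H₃ ⇒ X)))
  T₁ : Theory (λ X → ⊢ (H₁ ⇒ X))
  T₁ = assuming pra H₁
  T₂ : Theory (λ X → ⊢ (H₁ ⇒ (H₂ ⇒ X)))
  T₂ = assuming T₁ H₂
  T₃ : Theory ⊢₃
  T₃ = assuming T₂ H₃
  module W₀ = Reasoning pra
  module W₁ = Reasoning T₁
  module W₂ = Reasoning T₂
  module W₃ = Reasoning T₃
  h₁ : ⊢₃ H₁
  h₁ = W₂.weaken (W₁.weaken W₀.hyp)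
  h₂ : ⊢₃ H₂
  h₂ = W₂.weaken W₁.hyp
  h₃ : ⊢₃ H₃
  h₃ = W₂.hyp
  module Z = Reasoning (assuming T₃ (v₀ == 𝟎))
  v₀=0 : ⊢₃ ((v₀ == 𝟎) ⇒ (v₀ == v₁))
  v₀=0 = W₃.hyp Z.∙ Z.==-sym (Z.==-sym (Z.monus-zero v₁) Z.∙ Z.monus-congʳ v₁ (Z.==-sym W₃.hyp)
                              Z.∙ W₃.weaken h₃)
  T₄ : Theory (λ X → ⊢₃ ((v₀ == S (Pᵗ v₀)) ⇒ X))
  T₄ = assuming T₃ (v₀ == S (Pᵗ v₀))
  module W₄ = Reasoning T₄
  module Z′ = Reasoning (assuming T₄ (v₁ == 𝟎))
  module S′ = Reasoning (assuming T₄ (v₁ == S (Pᵗ v₁)))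
  up : ∀ {X} → ⊢₃ X → ⊢₃ ((v₀ == S (Pᵗ v₀)) ⇒ ((v₁ == S (Pᵗ v₁)) ⇒ X))
  up = W₄.weaken ∘ W₃.weaken
  v₀=S : ⊢₃ ((v₀ == S (Pᵗ v₀)) ⇒ (v₀ == v₁))
  v₀=S = case-zero-suc T₄ v₁ v₁=0 v₁=S
    where
    v₁=0 : ⊢₃ ((v₀ == S (Pᵗ v₀)) ⇒ ((v₁ == 𝟎) ⇒ (v₀ == v₁)))
    v₁=0 = Z′.zero-suc-absurd (Z′.==-sym (Z′.monus-zero v₀) Z′.∙ Z′.monus-congʳ v₀ (Z′.==-sym W₄.hyp)
                               Z′.∙ W₄.weaken (W₃.weaken h₂))
                              (W₄.weaken W₃.hyp)
    Pv₀-Pv₁ : ⊢₃ ((v₀ == S (Pᵗ v₀)) ⇒ ((v₁ == S (Pᵗ v₁)) ⇒ ((Pᵗ v₀ -ᵗ Pᵗ v₁) == 𝟎)))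
    Pv₀-Pv₁ = S′.==-sym (S′.lift (inst₂ monus-S-S (Pᵗ v₀) (Pᵗ v₁)))
              S′.∙ S′.monus-congˡ (S (Pᵗ v₁)) (S′.==-sym (W₄.weaken W₃.hyp))
              S′.∙ S′.monus-congʳ v₀ (S′.==-sym W₄.hyp) S′.∙ up h₂
    Pv₁-Pv₀ : ⊢₃ ((v₀ == S (Pᵗ v₀)) ⇒ ((v₁ == S (Pᵗ v₁)) ⇒ ((Pᵗ v₁ -ᵗ Pᵗ v₀) == 𝟎)))
    Pv₁-Pv₀ = S′.==-sym (S′.lift (inst₂ monus-S-S (Pᵗ v₁) (Pᵗ v₀)))
              S′.∙ S′.monus-congˡ (S (Pᵗ v₀)) (S′.==-sym W₄.hyp)
              S′.∙ S′.monus-congʳ v₁ (S′.==-sym (W₄.weaken W₃.hyp)) S′.∙ up h₃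
    v₁=S : ⊢₃ ((v₀ == S (Pᵗ v₀)) ⇒ ((v₁ == S (Pᵗ v₁)) ⇒ (v₀ == v₁)))
    v₁=S = W₄.weaken W₃.hyp S′.∙ S′.S-cong (S′.detach Pv₁-Pv₀ (S′.detach Pv₀-Pv₁ (up h₁)))
           S′.∙ S′.==-sym W₄.hyp

-- Induction on n for a ∸ (k ∸ n) and b ∸ (k ∸ n), where k = a + b: at n = 0 both
-- sides vanish, and at n = k they are a and b.
monus-antisym : ⊢ Antisymmetric v₀ v₁
monus-antisym = Antisymmetric-cong pra (monus-congʳ v₀ (inst₁ monus-self k) ∙ monus-zero v₀)
                                       (monus-congʳ v₁ (inst₁ monus-self k) ∙ monus-zero v₁)
                                       (inst₃ shifted v₀ v₁ k)
  where
  open Reasoning pra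
  k : Tm ℕ
  k = v₀ +ᵗ v₁
  Shifted : Tm ℕ → Fm
  Shifted n = Antisymmetric (v₀ -ᵗ (k -ᵗ n)) (v₁ -ᵗ (k -ᵗ n))
  base : ⊢ Shifted 𝟎
  base = weaken (weaken (monus-congʳ v₀ (monus-zero k) ∙ monus-plusˡ
                         ∙ ==-sym (monus-congʳ v₁ (monus-zero k) ∙ monus-plusʳ)))
  w : Tm ℕ
  w = k -ᵗ v₃
  T₁ : Theory (λ X → ⊢ (Shifted v₃ ⇒ X))
  T₁ = assuming pra (Shifted v₃)
  module W₁ = Reasoning T₁
  module Z = Reasoning (assuming T₁ (w == 𝟎))
  module S′ = Reasoning (assuming T₁ (w == S (Pᵗ w)))
  w=0 : ⊢ (Shifted v₃ ⇒ ((w == 𝟎) ⇒ Shifted (S v₃)))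
  w=0 = Antisymmetric-cong (assuming T₁ (w == 𝟎)) (Z.monus-congʳ v₀ (Z.==-sym w′=w))
                                                  (Z.monus-congʳ v₁ (Z.==-sym w′=w)) (W₁.weaken hyp)
    where
    w′=w : ⊢ (Shifted v₃ ⇒ ((w == 𝟎) ⇒ ((k -ᵗ S v₃) == w)))
    w′=w = Z.monus-suc k v₃ Z.∙ Z.P-cong W₁.hyp Z.∙ Z.P-zero Z.∙ Z.==-sym W₁.hyp
  w=S : ⊢ (Shifted v₃ ⇒ ((w == S (Pᵗ w)) ⇒ Shifted (S v₃)))
  w=S = S′.detach (Antisymmetric-cong (assuming T₁ (w == S (Pᵗ w)))
                     (S′.monus-congʳ v₀ w=Sw′ S′.∙ S′.monus-suc v₀ (k -ᵗ S v₃))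
                     (S′.monus-congʳ v₁ w=Sw′ S′.∙ S′.monus-suc v₁ (k -ᵗ S v₃)) (W₁.weaken hyp))
                  (S′.lift (inst₂ Antisymmetric-P (v₀ -ᵗ (k -ᵗ S v₃)) (v₁ -ᵗ (k -ᵗ S v₃))))
    where
    w=Sw′ : ⊢ (Shifted v₃ ⇒ ((w == S (Pᵗ w)) ⇒ (w == S (k -ᵗ S v₃))))
    w=Sw′ = W₁.hyp S′.∙ S′.S-cong (S′.==-sym (S′.monus-suc k v₃))
  shifted : ⊢ Shifted v₂
  shifted = ind {A = Shifted v₂} 2 3 refl base (case-zero-suc T₁ w w=0 w=S)

Eq-refl : ⊢ (Eqᵗ v₀ v₀ == 𝟎)
Eq-refl = plus-congˡ (v₀ -ᵗ v₀) monus-self ∙ plus-congʳ 𝟎 monus-self ∙ plus-zero 𝟎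
  where open Reasoning pra

Eq==𝟎 : ⊢ ((Eqᵗ v₀ v₁ == 𝟎) ⇒ (v₀ == v₁))
Eq==𝟎 = U.detach (summand plus==𝟎ʳ) (U.detach (summand plus==𝟎ˡ) (U.lift monus-antisym))
  where
  module U = Reasoning (assuming pra (Eqᵗ v₀ v₁ == 𝟎))
  summand : ∀ {X} → ⊢ (((v₀ +ᵗ v₁) == 𝟎) ⇒ X) →
            ⊢ ((Eqᵗ v₀ v₁ == 𝟎) ⇒ (X [ listSub ((v₀ -ᵗ v₁) ∷ (v₁ -ᵗ v₀) ∷ []) ]F))
  summand d = U.detach (Reasoning.hyp pra) (U.lift (inst₂ d (v₀ -ᵗ v₁) (v₁ -ᵗ v₀)))

≐-== : ⊢ ((v₀ == v₁) ⇒ ((v₀ ≐ v₁) == 𝟎))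
≐-== = U.replace ((v₂ ≐ v₀) == 𝟎) (listSub (v₀ ∷ v₁ ∷ v₀ ∷ [])) hyp
                 (U.lift (C-cong₁ 𝟎 𝟏 Eq-refl ∙ C-zero 𝟎 𝟏))
  where
  open Reasoning pra
  module U = Reasoning (assuming pra (v₀ == v₁))

≐-≠ : ⊢ ((v₀ ≠ v₁) ⇒ ((v₀ ≐ v₁) == 𝟏))
≐-≠ = C-≠0 (assuming pra (v₀ ≠ v₁)) 𝟎 𝟏 (U.detach hyp (U.lift (contraposition Eq==𝟎)))
  where
  open Reasoning pra
  module U = Reasoning (assuming pra (v₀ ≠ v₁))

≐𝟎-inv : ⊢ (((v₀ ≐ 𝟎) == 𝟎) ⇒ (v₀ == 𝟎))
≐𝟎-inv = U.by-cases U.⇒-refl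
                    (W.zero-suc-absurd (U.weaken hyp) (W.detach U.hyp (W.lift (inst₂ ≐-≠ v₀ 𝟎))))
  where
  open Reasoning pra
  T₁ : Theory (λ X → ⊢ (((v₀ ≐ 𝟎) == 𝟎) ⇒ X))
  T₁ = assuming pra ((v₀ ≐ 𝟎) == 𝟎)
  module U = Reasoning T₁
  module W = Reasoning (assuming T₁ (v₀ ≠ 𝟎))

¬̇-𝟏 : ⊢ ((v₀ == 𝟏) ⇒ ((¬̇ v₀) == 𝟎))
¬̇-𝟏 = U.C-cong₁ 𝟏 𝟎 hyp U.∙ U.C-suc 𝟎 𝟏 𝟎
  where
  open Reasoning pra
  module U = Reasoning (assuming pra (v₀ == 𝟏))

¬̇-𝟎 : ⊢ ((v₀ == 𝟎) ⇒ ((¬̇ v₀) == 𝟏))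
¬̇-𝟎 = C-=0 (assuming pra (v₀ == 𝟎)) 𝟏 𝟎 (Reasoning.hyp pra)

∨̇-𝟎ˡ : ⊢ ((v₀ == 𝟎) ⇒ ((v₀ ∨̇ v₁) == 𝟎))
∨̇-𝟎ˡ = C-=0 (assuming pra (v₀ == 𝟎)) 𝟎 (C v₁ 𝟎 𝟏) (Reasoning.hyp pra)

∨̇-𝟎ʳ : ⊢ ((v₁ == 𝟎) ⇒ ((v₀ ∨̇ v₁) == 𝟎))
∨̇-𝟎ʳ = U.C-cong₃ v₀ 𝟎 (C-=0 T₁ 𝟎 𝟏 hyp)
       U.∙ case-zero-suc T₁ v₀ (C-=0 (assuming T₁ (v₀ == 𝟎)) 𝟎 𝟎 U.hyp)
                               (W.C-cong₁ 𝟎 𝟎 U.hyp W.∙ W.C-suc (Pᵗ v₀) 𝟎 𝟎)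
  where
  open Reasoning pra
  T₁ : Theory (λ X → ⊢ ((v₁ == 𝟎) ⇒ X))
  T₁ = assuming pra (v₁ == 𝟎)
  module U = Reasoning T₁
  module W = Reasoning (assuming T₁ (v₀ == S (Pᵗ v₀)))

∨̇-𝟏 : ⊢ ((v₀ == 𝟏) ⇒ ((v₁ == 𝟏) ⇒ ((v₀ ∨̇ v₁) == 𝟏)))
∨̇-𝟏 = W.C-cong₁ 𝟎 (C v₁ 𝟎 𝟏) (U.weaken hyp) W.∙ W.C-suc 𝟎 𝟎 (C v₁ 𝟎 𝟏)
      W.∙ W.C-cong₁ 𝟎 𝟏 U.hyp W.∙ W.C-suc 𝟎 𝟎 𝟏
  where
  open Reasoning pra
  T₁ : Theory (λ X → ⊢ ((v₀ == 𝟏) ⇒ X))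
  T₁ = assuming pra (v₀ == 𝟏)
  module U = Reasoning T₁
  module W = Reasoning (assuming T₁ (v₁ == 𝟏))

χ-characteristic : ∀ A → (⊢ (A ⇒ (χ A == 𝟎))) × (⊢ ((~ A) ⇒ (χ A == 𝟏)))
χ-characteristic (a == b) = inst₂ ≐-== a b , inst₂ ≐-≠ a b
χ-characteristic (~ A) =
  ⇒-trans (proj₂ (χ-characteristic A)) (inst₁ ¬̇-𝟏 (χ A)) ,
  ⇒-trans ¬¬-elim (⇒-trans (proj₁ (χ-characteristic A)) (inst₁ ¬̇-𝟎 (χ A)))
  where open Reasoning pra
χ-characteristic (A ∨ B) =
  ∨-elim⇒ (⇒-trans (proj₁ (χ-characteristic A)) (inst₂ ∨̇-𝟎ˡ (χ A) (χ B)))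
          (⇒-trans (proj₁ (χ-characteristic B)) (inst₂ ∨̇-𝟎ʳ (χ A) (χ B))) ,
  U.detach (U.detach (U.¬∨-elimʳ hyp) (U.lift (proj₂ (χ-characteristic B))))
           (U.detach (U.detach (U.¬∨-elimˡ hyp) (U.lift (proj₂ (χ-characteristic A))))
                     (U.lift (inst₂ ∨̇-𝟏 (χ A) (χ B))))
  where
  open Reasoning pra
  module U = Reasoning (assuming pra (~ (A ∨ B)))

occurs-∈ : ∀ {v l} → v ∈ l → occurs v l ≡ true
occurs-∈ {v}         (here refl)  rewrite ≡ᵇ-refl v  = refl
occurs-∈ {v} {w ∷ l} (there v∈l) rewrite occurs-∈ v∈l = ∨-zeroʳ (w ≡ᵇ v)

occurs≡false⇒∉ : ∀ {v l} → occurs v l ≡ false → v ∉ l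
occurs≡false⇒∉ ¬occ v∈l with () ← trans (sym (occurs-∈ v∈l)) ¬occ

∉⇒occurs≡false : ∀ {v} l → v ∉ l → occurs v l ≡ false
∉⇒occurs≡false []      v∉l = refl
∉⇒occurs≡false (w ∷ l) v∉l
  rewrite ≢⇒≡ᵇ≡false (v∉l ∘ here ∘ sym) = ∉⇒occurs≡false l (v∉l ∘ there)

≤-foldr-⊔ : ∀ {v} (l : List ℕ) → v ∈ l → v ≤ foldr _⊔_ 0 l
≤-foldr-⊔ (w ∷ l) (here refl)  = m≤m⊔n w (foldr _⊔_ 0 l)
≤-foldr-⊔ (w ∷ l) (there v∈l) = ≤-trans (≤-foldr-⊔ l v∈l) (m≤n⊔m w (foldr _⊔_ 0 l))

fresh : List ℕ → ℕ
fresh l = suc (foldr _⊔_ 0 l)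

fresh-∉ : ∀ l → fresh l ∉ l
fresh-∉ l fresh∈l = n≮n _ (≤-foldr-⊔ l fresh∈l)

isOtherVar : Fm → ℕ → ℕ → Bool
isOtherVar A z v = occurs v (varsF A) ∧ not (v ≡ᵇ z)

∈-otherVars : ∀ A z {v} → v ∈ varsF A → v ≢ z → v ∈ otherVars A z
∈-otherVars A z {v} v∈A v≢z =
  ∈-filter⁺ (T? ∘ isOtherVar A z) (∈-upTo⁺ (s≤s (≤-foldr-⊔ (varsF A) v∈A))) other
  where
  other : T (isOtherVar A z v)
  other rewrite occurs-∈ v∈A | ≢⇒≡ᵇ≡false v≢z = tt

∉-otherVars : ∀ A z → z ∉ otherVars A z
∉-otherVars A z z∈ys = notOther (proj₂ (∈-filter⁻ (T? ∘ isOtherVar A z) z∈ys))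
  where
  notOther : ¬ T (isOtherVar A z z)
  notOther rewrite ≡ᵇ-refl z | ∧-zeroʳ (occurs z (varsF A)) = λ ()

indexOf-∈ : ∀ {v} (l : List ℕ) → v ∈ l →
            Σ (Fin (length l)) λ i → (indexOf l v ≡ just i) × (lookup (vfromList l) i ≡ v)
indexOf-∈ {v} (w ∷ l) v∈l with w ≡ᵇ v in w≡ᵇv
... | true  = fzero , refl , ≡ᵇ⇒≡ w v (Equivalence.from T-≡ w≡ᵇv)
indexOf-∈ {v} (w ∷ l) (here refl) | false with () ← trans (sym (≡ᵇ-refl v)) w≡ᵇv
indexOf-∈ {v} (w ∷ l) (there v∈l) | false with indexOf-∈ l v∈l
... | i , index≡i , lookup≡v rewrite index≡i = fsuc i , refl , lookup≡v

-- Defining equations and μ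

-- The substitution x⃗ ↦ ts, y ↦ u in the variable numbering of the defining equations.
paramSub : ∀ {n} → Vec (Tm ℕ) n → Tm ℕ → ℕ → Tm ℕ
paramSub []       u v       = u
paramSub (t ∷ ts) u zero    = t
paramSub (t ∷ ts) u (suc v) = paramSub ts u v

paramSub-toℕ : ∀ {n} (ts : Vec (Tm ℕ) n) u (i : Fin n) → paramSub ts u (toℕ i) ≡ lookup ts i
paramSub-toℕ (t ∷ ts) u fzero    = refl
paramSub-toℕ (t ∷ ts) u (fsuc i) = paramSub-toℕ ts u i

paramSub-length : ∀ {n} (ts : Vec (Tm ℕ) n) u → paramSub ts u n ≡ u
paramSub-length []       u = refl
paramSub-length (t ∷ ts) u = paramSub-length ts u

paramSub-∷ʳ : ∀ {n} (ts : Vec (Tm ℕ) n) u r {v} → v ≤ n → paramSub ts u v ≡ paramSub (ts ∷ʳ u) r v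
paramSub-∷ʳ []       u r z≤n       = refl
paramSub-∷ʳ (t ∷ ts) u r z≤n       = refl
paramSub-∷ʳ (t ∷ ts) u r (s≤s v≤n) = paramSub-∷ʳ ts u r v≤n

params-paramSub : ∀ {n} (ts : Vec (Tm ℕ) n) u a →
                  (params n ∷ʳ a) ⟦ paramSub ts u ⟧* ≡ ts ∷ʳ (a ⟦ paramSub ts u ⟧)
params-paramSub {n} ts u a = begin
  (params n ∷ʳ a) ⟦ σ ⟧*                  ≡⟨ ⟦⟧*-map (params n ∷ʳ a) σ ⟩
  vmap (_⟦ σ ⟧) (params n ∷ʳ a)           ≡⟨ map-∷ʳ (_⟦ σ ⟧) a (params n) ⟩
  vmap (_⟦ σ ⟧) (params n) ∷ʳ (a ⟦ σ ⟧)   ≡⟨ cong (_∷ʳ (a ⟦ σ ⟧)) (tabulate-∘ (_⟦ σ ⟧) (var ∘ toℕ)) ⟨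
  tabulate (σ ∘ toℕ) ∷ʳ (a ⟦ σ ⟧)         ≡⟨ cong (_∷ʳ (a ⟦ σ ⟧)) (tabulate-cong (paramSub-toℕ ts u)) ⟩
  tabulate (lookup ts) ∷ʳ (a ⟦ σ ⟧)       ≡⟨ cong (_∷ʳ (a ⟦ σ ⟧)) (tabulate∘lookup ts) ⟩
  ts ∷ʳ (a ⟦ σ ⟧)                         ∎
  where
  open ≡-Reasoning
  σ : ℕ → Tm ℕ
  σ = paramSub ts u

rec-zero : ∀ {n} (a : Tm (Fin n)) (b : Tm (Fin (suc (suc n)))) (ts : Vec (Tm ℕ) n) →
           ⊢ (app (rec a b) (ts ∷ʳ 𝟎) == a ⟦ lookup ts ⟧)
rec-zero a b ts = subst ⊢_ (cong₂ _==_ (cong (app (rec a b)) (params-paramSub ts 𝟎 𝟎)) a-instance)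
                           (inst (ax (defEq₀ a b)) (paramSub ts 𝟎))
  where
  a-instance : embed a ⟦ paramSub ts 𝟎 ⟧ ≡ a ⟦ lookup ts ⟧
  a-instance = trans (⟦⟧-⟦⟧ a (var ∘ toℕ) (paramSub ts 𝟎))
                     (⟦⟧-cong a (λ i _ → paramSub-toℕ ts 𝟎 i))

rec-suc : ∀ {n} (a : Tm (Fin n)) (b : Tm (Fin (suc (suc n)))) (ts : Vec (Tm ℕ) n) (u : Tm ℕ) →
          ⊢ (app (rec a b) (ts ∷ʳ S u) == b ⟦ lookup (ts ∷ʳ u ∷ʳ app (rec a b) (ts ∷ʳ u)) ⟧)
rec-suc {n} a b ts u = subst ⊢_ (cong₂ _==_ lhs rhs) (inst (ax (defEqS a b)) σ)
  where
  σ : ℕ → Tm ℕ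
  σ = paramSub ts u
  R r : Tm ℕ
  R = app (rec a b) (params n ∷ʳ var n)
  r = app (rec a b) (ts ∷ʳ u)
  σn≡u : σ n ≡ u
  σn≡u = paramSub-length ts u
  R-instance : R ⟦ σ ⟧ ≡ r
  R-instance = cong (app (rec a b)) (trans (params-paramSub ts u (var n)) (cong (ts ∷ʳ_) σn≡u))
  lhs : app (rec a b) ((params n ∷ʳ S (var n)) ⟦ σ ⟧*) ≡ app (rec a b) (ts ∷ʳ S u)
  lhs = cong (app (rec a b)) (trans (params-paramSub ts u (S (var n))) (cong (λ w → ts ∷ʳ S w) σn≡u))
  pointwise : ∀ {v} → v ≤ suc n → (suc n ↦ R) v ⟦ σ ⟧ ≡ paramSub (ts ∷ʳ u ∷ʳ r) 𝟎 v
  pointwise {v} v≤1+n with v ≟ suc n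
  ... | yes refl = begin
    (suc n ↦ R) (suc n) ⟦ σ ⟧             ≡⟨ cong (_⟦ σ ⟧) (↦-≡ (suc n) R) ⟩
    R ⟦ σ ⟧                               ≡⟨ R-instance ⟩
    r                                     ≡⟨ paramSub-length (ts ∷ʳ u) r ⟨
    paramSub (ts ∷ʳ u) r (suc n)          ≡⟨ paramSub-∷ʳ (ts ∷ʳ u) r 𝟎 ≤-refl ⟩
    paramSub (ts ∷ʳ u ∷ʳ r) 𝟎 (suc n)     ∎
    where open ≡-Reasoning
  ... | no v≢1+n = begin
    (suc n ↦ R) v ⟦ σ ⟧                   ≡⟨ cong (_⟦ σ ⟧) (↦-≢ R v≢1+n) ⟩
    σ v                                   ≡⟨ paramSub-∷ʳ ts u r (s≤s⁻¹ (≤∧≢⇒< v≤1+n v≢1+n)) ⟩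
    paramSub (ts ∷ʳ u) r v                ≡⟨ paramSub-∷ʳ (ts ∷ʳ u) r 𝟎 v≤1+n ⟩
    paramSub (ts ∷ʳ u ∷ʳ r) 𝟎 v           ∎
    where open ≡-Reasoning
  rhs : embed b ⟦ suc n ↦ R ⟧ ⟦ σ ⟧ ≡ b ⟦ lookup (ts ∷ʳ u ∷ʳ r) ⟧
  rhs = begin
    embed b ⟦ suc n ↦ R ⟧ ⟦ σ ⟧                    ≡⟨ cong (_⟦ σ ⟧) (⟦⟧-⟦⟧ b (var ∘ toℕ) (suc n ↦ R)) ⟩
    b ⟦ (var ∘ toℕ) ⨾ (suc n ↦ R) ⟧ ⟦ σ ⟧          ≡⟨ ⟦⟧-⟦⟧ b _ σ ⟩
    b ⟦ ((var ∘ toℕ) ⨾ (suc n ↦ R)) ⨾ σ ⟧          ≡⟨ ⟦⟧-cong b (λ i _ → pointwise (toℕ≤pred[n] i)) ⟩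
    b ⟦ paramSub (ts ∷ʳ u ∷ʳ r) 𝟎 ∘ toℕ ⟧          ≡⟨ ⟦⟧-cong b (λ i _ → paramSub-toℕ (ts ∷ʳ u ∷ʳ r) 𝟎 i) ⟩
    b ⟦ lookup (ts ∷ʳ u ∷ʳ r) ⟧                    ∎
    where open ≡-Reasoning

lookup-∷ʳ-inject₁ : ∀ {A : Set} {n} (xs : Vec A n) x (i : Fin n) →
                    lookup (xs ∷ʳ x) (inject₁ i) ≡ lookup xs i
lookup-∷ʳ-inject₁ (y ∷ xs) x fzero    = refl
lookup-∷ʳ-inject₁ (y ∷ xs) x (fsuc i) = lookup-∷ʳ-inject₁ xs x i

lookup-∷ʳ-fromℕ : ∀ {A : Set} {n} (xs : Vec A n) x → lookup (xs ∷ʳ x) (fromℕ n) ≡ x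
lookup-∷ʳ-fromℕ []       x = refl
lookup-∷ʳ-fromℕ (y ∷ xs) x = lookup-∷ʳ-fromℕ xs x

vars-⟦⟧ : ∀ (l : List ℕ) (σ : ℕ → Tm ℕ) → (∀ v → v ∈ l → σ v ≡ var v) →
          vmap var (vfromList l) ⟦ σ ⟧* ≡ vmap var (vfromList l)
vars-⟦⟧ []      σ σ-fixes = refl
vars-⟦⟧ (v ∷ l) σ σ-fixes =
  cong₂ _∷_ (σ-fixes v (here refl)) (vars-⟦⟧ l σ (λ w → σ-fixes w ∘ there))

module μ-Equations (F : Fm) (z : ℕ) where

  ys : List ℕ
  ys = otherVars F z

  vys : Vec (Tm ℕ) (length ys)
  vys = vmap var (vfromList ys)

  scope-≡ : ∀ {W : Set} (tx : Tm W) (ι : Fin (length ys) → Tm W) → scope ys z tx ι z ≡ tx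
  scope-≡ tx ι rewrite ≡ᵇ-refl z = refl

  scope-≢ : ∀ {W : Set} (tx : Tm W) (ι : Fin (length ys) → Tm W) (τ : W → Tm ℕ) →
            (∀ i → ι i ⟦ τ ⟧ ≡ lookup vys i) →
            ∀ {v} → v ∈ varsF F → v ≢ z → scope ys z tx ι v ⟦ τ ⟧ ≡ var v
  scope-≢ tx ι τ ι-τ {v} v∈F v≢z with indexOf-∈ ys (∈-otherVars F z v∈F v≢z)
  ... | i , index≡i , lookup≡v rewrite ≢⇒≡ᵇ≡false v≢z | index≡i =
    trans (ι-τ i) (trans (lookup-map i var (vfromList ys)) (cong var lookup≡v))

  χ-scope : ∀ {W : Set} (s : Tm ℕ) (tx : Tm W) (ι : Fin (length ys) → Tm W) (τ : W → Tm ℕ) →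
            (∀ i → ι i ⟦ τ ⟧ ≡ lookup vys i) →
            χ (F [ z ≔ s ]) ⟦ scope ys z tx ι ⟧ ⟦ τ ⟧ ≡ χ F ⟦ z ↦ (s ⟦ scope ys z tx ι ⟧ ⟦ τ ⟧) ⟧
  χ-scope {W} s tx ι τ ι-τ = begin
    χ (F [ z ≔ s ]) ⟦ sc ⟧ ⟦ τ ⟧   ≡⟨ cong (λ w → w ⟦ sc ⟧ ⟦ τ ⟧) (χ-[]F F (z ↦ s)) ⟩
    χ F ⟦ z ↦ s ⟧ ⟦ sc ⟧ ⟦ τ ⟧     ≡⟨ cong (_⟦ τ ⟧) (⟦⟧-⟦⟧ (χ F) (z ↦ s) sc) ⟩
    χ F ⟦ (z ↦ s) ⨾ sc ⟧ ⟦ τ ⟧     ≡⟨ ⟦⟧-⟦⟧ (χ F) _ τ ⟩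
    χ F ⟦ ((z ↦ s) ⨾ sc) ⨾ τ ⟧     ≡⟨ χ-⟦⟧-cong F pointwise ⟩
    χ F ⟦ z ↦ s′ ⟧                 ∎
    where
    open ≡-Reasoning
    sc : ℕ → Tm W
    sc = scope ys z tx ι
    s′ : Tm ℕ
    s′ = s ⟦ sc ⟧ ⟦ τ ⟧
    pointwise : ∀ v → v ∈ varsF F → (((z ↦ s) ⨾ sc) ⨾ τ) v ≡ (z ↦ s′) v
    pointwise v v∈F with v ≟ z
    ... | yes refl = trans (cong (λ w → w ⟦ sc ⟧ ⟦ τ ⟧) (↦-≡ z s)) (sym (↦-≡ z s′))
    ... | no v≢z   = begin
      (z ↦ s) v ⟦ sc ⟧ ⟦ τ ⟧   ≡⟨ cong (λ w → w ⟦ sc ⟧ ⟦ τ ⟧) (↦-≢ s v≢z) ⟩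
      sc v ⟦ τ ⟧              ≡⟨ scope-≢ tx ι τ ι-τ v∈F v≢z ⟩
      var v                   ≡⟨ ↦-≢ s′ v≢z ⟨
      (z ↦ s′) v              ∎

  μ-zero : ⊢ (μ F z 𝟎 == C (χ F ⟦ z ↦ 𝟎 ⟧) 𝟎 𝟏)
  μ-zero = subst (λ w → ⊢ (μ F z 𝟎 == C w 𝟎 𝟏)) (χ-scope 𝟎 𝟎 var (lookup vys) (λ _ → refl))
                 (rec-zero _ _ vys)

  μ-suc : ∀ u → ⊢ (μ F z (S u) == C ((μ F z u -ᵗ u) ≐ 𝟎) (μ F z u)
                                       (C (χ F ⟦ z ↦ S u ⟧) (S u) (S (S u))))
  μ-suc u = subst (λ w → ⊢ (μ F z (S u) == w)) instance-shape (rec-suc _ _ vys u)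
    where
    m : ℕ
    m = length ys
    L : Vec (Tm ℕ) (suc (suc m))
    L = vys ∷ʳ u ∷ʳ μ F z u
    X Z : Tm (Fin (suc (suc m)))
    X = var (inject₁ (fromℕ m))
    Z = var (fromℕ (suc m))
    ι : Fin m → Tm (Fin (suc (suc m)))
    ι i = var (inject₁ (inject₁ i))
    Z-instance : Z ⟦ lookup L ⟧ ≡ μ F z u
    Z-instance = lookup-∷ʳ-fromℕ (vys ∷ʳ u) (μ F z u)
    X-instance : X ⟦ lookup L ⟧ ≡ u
    X-instance = trans (lookup-∷ʳ-inject₁ (vys ∷ʳ u) (μ F z u) (fromℕ m)) (lookup-∷ʳ-fromℕ vys u)
    ι-instance : ∀ i → ι i ⟦ lookup L ⟧ ≡ lookup vys i
    ι-instance i = trans (lookup-∷ʳ-inject₁ (vys ∷ʳ u) (μ F z u) (inject₁ i)) (lookup-∷ʳ-inject₁ vys u i)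
    χ-instance : χ (F [ z ≔ S (var z) ]) ⟦ scope ys z X ι ⟧ ⟦ lookup L ⟧ ≡ χ F ⟦ z ↦ S u ⟧
    χ-instance = begin
      χ (F [ z ≔ S (var z) ]) ⟦ scope ys z X ι ⟧ ⟦ lookup L ⟧
        ≡⟨ χ-scope (S (var z)) X ι (lookup L) ι-instance ⟩
      χ F ⟦ z ↦ S (scope ys z X ι z ⟦ lookup L ⟧) ⟧
        ≡⟨ cong (λ w → χ F ⟦ z ↦ S (w ⟦ lookup L ⟧) ⟧) (scope-≡ X ι) ⟩
      χ F ⟦ z ↦ S (X ⟦ lookup L ⟧) ⟧
        ≡⟨ cong (λ w → χ F ⟦ z ↦ S w ⟧) X-instance ⟩
      χ F ⟦ z ↦ S u ⟧ ∎
      where open ≡-Reasoning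
    shape : Tm ℕ → Tm ℕ → Tm ℕ → Tm ℕ
    shape y x h = C ((y -ᵗ x) ≐ 𝟎) y (C h (S x) (S (S x)))
    instance-shape : shape (Z ⟦ lookup L ⟧) (X ⟦ lookup L ⟧)
                           (χ (F [ z ≔ S (var z) ]) ⟦ scope ys z X ι ⟧ ⟦ lookup L ⟧)
                     ≡ shape (μ F z u) u (χ F ⟦ z ↦ S u ⟧)
    instance-shape rewrite Z-instance | X-instance | χ-instance = refl

  μ-⟦⟧ : ∀ (σ : ℕ → Tm ℕ) a → (∀ v → v ∈ ys → σ v ≡ var v) → μ F z a ⟦ σ ⟧ ≡ μ F z (a ⟦ σ ⟧)
  μ-⟦⟧ σ a σ-fixes = cong (app (μSym F z)) (begin
    (vys ∷ʳ a) ⟦ σ ⟧*              ≡⟨ ⟦⟧*-map (vys ∷ʳ a) σ ⟩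
    vmap (_⟦ σ ⟧) (vys ∷ʳ a)       ≡⟨ map-∷ʳ (_⟦ σ ⟧) a vys ⟩
    vmap (_⟦ σ ⟧) vys ∷ʳ a ⟦ σ ⟧   ≡⟨ cong (_∷ʳ a ⟦ σ ⟧) (⟦⟧*-map vys σ) ⟨
    vys ⟦ σ ⟧* ∷ʳ a ⟦ σ ⟧          ≡⟨ cong (_∷ʳ a ⟦ σ ⟧) (vars-⟦⟧ ys σ σ-fixes) ⟩
    vys ∷ʳ a ⟦ σ ⟧                 ∎)
    where open ≡-Reasoning

-- The induction schema in PRA

-- Instantiate the substitution axiom at a variable y fresh for A, sending z to a and y to b
-- simultaneously, since a and b may mention z or y.
leibniz : ∀ A z a b → ⊢ ((a == b) ⇒ ((A [ z ≔ a ]) ⇒ (A [ z ≔ b ])))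
leibniz A z a b = subst ⊢_ (trans (cong₂ (λ p q → (σ z == σ y) ⇒ (p ⇒ q)) A[z] A[y]) σ-ends)
                           (inst (Propositional.curry (Theory.hilbert pra) (ax (eqSubst z y A))) σ)
  where
  y : ℕ
  y = fresh (z ∷ varsF A)
  y≢z : y ≢ z
  y≢z = fresh-∉ (z ∷ varsF A) ∘ here
  A∌y : ∀ w → w ∈ varsF A → w ≢ y
  A∌y w w∈A refl = fresh-∉ (z ∷ varsF A) (there w∈A)
  σ : ℕ → Tm ℕ
  σ v = if v ≡ᵇ y then b else (z ↦ a) v
  σ-y : σ y ≡ b
  σ-y rewrite ≡ᵇ-refl y = refl
  σ-z : σ z ≡ a
  σ-z rewrite ≢⇒≡ᵇ≡false (y≢z ∘ sym) = ↦-≡ z a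
  σ-A : ∀ w → w ∈ varsF A → w ≢ z → σ w ≡ var w
  σ-A w w∈A w≢z rewrite ≢⇒≡ᵇ≡false (A∌y w w∈A) = ↦-≢ a w≢z
  σ-ends : ((σ z == σ y) ⇒ ((A [ z ≔ a ]) ⇒ (A [ z ≔ b ])))
           ≡ ((a == b) ⇒ ((A [ z ≔ a ]) ⇒ (A [ z ≔ b ])))
  σ-ends rewrite σ-z | σ-y = refl
  after : ∀ (s e : Tm ℕ) → s ⟦ σ ⟧ ≡ e → A [ z ≔ s ] [ σ ]F ≡ A [ z ≔ e ]
  after s e s-σ = trans ([]F-[]F A (z ↦ s) σ) ([]F-cong A pointwise)
    where
    open ≡-Reasoning
    pointwise : ∀ w → w ∈ varsF A → ((z ↦ s) ⨾ σ) w ≡ (z ↦ e) w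
    pointwise w w∈A with w ≟ z
    ... | yes refl = begin
      (z ↦ s) z ⟦ σ ⟧  ≡⟨ cong (_⟦ σ ⟧) (↦-≡ z s) ⟩
      s ⟦ σ ⟧          ≡⟨ s-σ ⟩
      e                ≡⟨ ↦-≡ z e ⟨
      (z ↦ e) z        ∎
    ... | no w≢z = begin
      (z ↦ s) w ⟦ σ ⟧  ≡⟨ cong (_⟦ σ ⟧) (↦-≢ s w≢z) ⟩
      σ w              ≡⟨ σ-A w w∈A w≢z ⟩
      var w            ≡⟨ ↦-≢ e w≢z ⟨
      (z ↦ e) w        ∎
  A[z] : A [ z ≔ var z ] [ σ ]F ≡ A [ z ≔ a ]
  A[z] = after (var z) a σ-z
  A[y] : A [ z ≔ var y ] [ σ ]F ≡ A [ z ≔ b ]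
  A[y] = after (var y) b σ-y

module Rules {P : Fm → Set} (T : Theory P) where
  open Reasoning T public

  replace-at : ∀ A z {a b} → P (a == b) → P (A [ z ≔ a ]) → P (A [ z ≔ b ])
  replace-at A z {a} {b} a=b d = detach d (detach a=b (lift (leibniz A z a b)))

  S⇒≠0 : ∀ {u w} → P (u == S w) → P (u ≠ 𝟎)
  S⇒≠0 {u} u=S = by-cases (U.zero-suc-absurd hyp (weaken u=S)) ⇒-refl
    where module U = Reasoning (assuming T (u == 𝟎))

  ≐𝟎-== : ∀ {u} → P (u == 𝟎) → P ((u ≐ 𝟎) == 𝟎)
  ≐𝟎-== {u} u=0 = detach u=0 (lift (inst₂ ≐-== u 𝟎))

  ≐𝟎-≠ : ∀ {u} → P (u ≠ 𝟎) → P ((u ≐ 𝟎) == 𝟏)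
  ≐𝟎-≠ {u} u≠0 = detach u≠0 (lift (inst₂ ≐-≠ u 𝟎))

  ≐𝟎-==⁻ : ∀ {u} → P ((u ≐ 𝟎) == 𝟎) → P (u == 𝟎)
  ≐𝟎-==⁻ {u} c=0 = detach c=0 (lift (inst₁ ≐𝟎-inv u))

module InductionSchema (A : Fm) (x x′ : ℕ) (x′∉A : occurs x′ (varsF A) ≡ false) where

  Aᵘ : Tm ℕ → Fm
  Aᵘ u = A [ x ≔ u ]

  Step : Tm ℕ → Fm
  Step u = Aᵘ u ⇒ Aᵘ (S u)

  N : Fm
  N = ~ Step (var x′)

  open μ-Equations N x′

  t : Tm ℕ → Tm ℕ
  t = μ N x′

  h : Tm ℕ → Tm ℕ
  h u = χ N ⟦ x′ ↦ u ⟧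

  c : Tm ℕ → Tm ℕ
  c b = (t b -ᵗ b) ≐ 𝟎

  Aᵘ-[x′≔] : ∀ s u → Aᵘ s [ x′ ≔ u ] ≡ Aᵘ (s ⟦ x′ ↦ u ⟧)
  Aᵘ-[x′≔] s u = ≔-≔-absent A x x′ s u (λ { w w∈A refl → occurs≡false⇒∉ x′∉A w∈A })

  Step-[x′≔] : ∀ u → Step (var x′) [ x′ ≔ u ] ≡ Step u
  Step-[x′≔] u = cong₂ _⇒_ (trans (Aᵘ-[x′≔] (var x′) u) (cong Aᵘ (↦-≡ x′ u)))
                           (trans (Aᵘ-[x′≔] (S (var x′)) u) (cong (Aᵘ ∘ S) (↦-≡ x′ u)))

  refuted : ∀ u → ⊢ (~ Step u ⇒ (h u == 𝟎))
  refuted u = subst₂ (λ p q → ⊢ (~ p ⇒ (q == 𝟎))) (Step-[x′≔] u) (χ-[]F N (x′ ↦ u))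
                     (proj₁ (χ-characteristic (N [ x′ ≔ u ])))

  unrefuted : ∀ u → ⊢ (~ ~ Step u ⇒ (h u == 𝟏))
  unrefuted u = subst₂ (λ p q → ⊢ (~ ~ p ⇒ (q == 𝟏))) (Step-[x′≔] u) (χ-[]F N (x′ ↦ u))
                       (proj₂ (χ-characteristic (N [ x′ ≔ u ])))

  Shape : Tm ℕ → Tm ℕ → Fm → Fm → Fm
  Shape cb htb A₀ A₁ = ((cb == 𝟎) ⇒ (htb == 𝟎)) ∧ᶠ ((cb ≠ 𝟎) ⇒ (A₀ ⇒ A₁))

  Invariant : Tm ℕ → Fm
  Invariant b = Shape (c b) (h (t b)) (Aᵘ 𝟎) (Aᵘ (S b))

  invariant-zero : ⊢ Invariant 𝟎
  invariant-zero = by-cases {h 𝟎 == 𝟎} found not-found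
    where
    open Reasoning pra
    module U = Rules (assuming pra (h 𝟎 == 𝟎))
    module V = Rules (assuming pra (h 𝟎 ≠ 𝟎))
    t0=0 : ⊢ ((h 𝟎 == 𝟎) ⇒ (t 𝟎 == 𝟎))
    t0=0 = U.lift μ-zero U.∙ C-=0 (assuming pra (h 𝟎 == 𝟎)) 𝟎 𝟏 hyp
    found : ⊢ ((h 𝟎 == 𝟎) ⇒ Invariant 𝟎)
    found = U.∧-intro (U.weaken (U.replace-at (χ N == 𝟎) x′ (U.==-sym t0=0) hyp))
                      (U.vacuous (U.≐𝟎-== (U.monus-zero (t 𝟎) U.∙ t0=0)))
    t0=1 : ⊢ ((h 𝟎 ≠ 𝟎) ⇒ (t 𝟎 == 𝟏))
    t0=1 = V.lift μ-zero V.∙ C-≠0 (assuming pra (h 𝟎 ≠ 𝟎)) 𝟎 𝟏 hyp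
    not-found : ⊢ ((h 𝟎 ≠ 𝟎) ⇒ Invariant 𝟎)
    not-found = V.∧-intro (V.vacuous¬ (V.S⇒≠0 (V.≐𝟎-≠ (V.S⇒≠0 (V.monus-zero (t 𝟎) V.∙ t0=1)))))
                          (V.weaken (V.detach (V.modus-tollens (V.lift (refuted 𝟎)) hyp) V.¬¬-elim))

  invariant-suc : ∀ b → ⊢ (Invariant b ⇒ Invariant (S b))
  invariant-suc b = U.by-cases {c b == 𝟎} found not-found
    where
    open Reasoning pra
    T₁ : Theory (λ X → ⊢ (Invariant b ⇒ X))
    T₁ = assuming pra (Invariant b)
    module U = Rules T₁
    tSb : Tm ℕ
    tSb = C (h (S b)) (S b) (S (S b))
    module V = Rules (assuming T₁ (c b == 𝟎))
    tSb=tb : ⊢ (Invariant b ⇒ ((c b == 𝟎) ⇒ (t (S b) == t b)))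
    tSb=tb = V.lift (μ-suc b) V.∙ C-=0 (assuming T₁ (c b == 𝟎)) (t b) tSb U.hyp
    found : ⊢ (Invariant b ⇒ ((c b == 𝟎) ⇒ Invariant (S b)))
    found = V.∧-intro (V.weaken (V.replace-at (χ N == 𝟎) x′ (V.==-sym tSb=tb)
                                              (V.detach U.hyp (U.weaken (U.∧-elimˡ hyp)))))
                      (V.vacuous (V.≐𝟎-== (V.monus-congˡ (S b) tSb=tb V.∙ V.monus-suc (t b) b
                                           V.∙ V.P-cong (V.≐𝟎-==⁻ U.hyp) V.∙ V.P-zero)))
    T₂ : Theory (λ X → ⊢ (Invariant b ⇒ ((c b ≠ 𝟎) ⇒ X)))
    T₂ = assuming T₁ (c b ≠ 𝟎)
    module W = Rules T₂
    A₀⇒ASb : ⊢ (Invariant b ⇒ ((c b ≠ 𝟎) ⇒ (Aᵘ 𝟎 ⇒ Aᵘ (S b))))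
    A₀⇒ASb = W.detach U.hyp (U.weaken (U.∧-elimʳ hyp))
    tSb=C : ⊢ (Invariant b ⇒ ((c b ≠ 𝟎) ⇒ (t (S b) == tSb)))
    tSb=C = W.lift (μ-suc b) W.∙ C-≠0 T₂ (t b) tSb U.hyp
    module X = Rules (assuming T₂ (h (S b) == 𝟎))
    module Y = Rules (assuming T₂ (h (S b) ≠ 𝟎))
    tSSb=Sb : ⊢ (Invariant b ⇒ ((c b ≠ 𝟎) ⇒ ((h (S b) == 𝟎) ⇒ (t (S b) == S b))))
    tSSb=Sb = W.weaken tSb=C X.∙ C-=0 (assuming T₂ (h (S b) == 𝟎)) (S b) (S (S b)) W.hyp
    found-now : ⊢ (Invariant b ⇒ ((c b ≠ 𝟎) ⇒ ((h (S b) == 𝟎) ⇒ Invariant (S b))))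
    found-now = X.∧-intro (X.weaken (X.replace-at (χ N == 𝟎) x′ (X.==-sym tSSb=Sb) W.hyp))
                          (X.vacuous (X.≐𝟎-== (X.monus-congˡ (S b) tSSb=Sb
                                               X.∙ X.lift (inst₁ monus-self (S b)))))
    tSSb=SSb : ⊢ (Invariant b ⇒ ((c b ≠ 𝟎) ⇒ ((h (S b) ≠ 𝟎) ⇒ (t (S b) == S (S b)))))
    tSSb=SSb = W.weaken tSb=C Y.∙ C-≠0 (assuming T₂ (h (S b) ≠ 𝟎)) (S b) (S (S b)) W.hyp
    still-not-found : ⊢ (Invariant b ⇒ ((c b ≠ 𝟎) ⇒ ((h (S b) ≠ 𝟎) ⇒ Invariant (S b))))
    still-not-found =
      Y.∧-intro (Y.vacuous¬ (Y.S⇒≠0 (Y.≐𝟎-≠ (Y.S⇒≠0 (Y.monus-congˡ (S b) tSSb=SSb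
                                                      Y.∙ Y.lift (inst₁ monus-S-self (S b)))))))
                (Y.weaken (Y.⇒-trans (W.weaken A₀⇒ASb)
                                     (Y.detach (Y.modus-tollens (Y.lift (refuted (S b))) W.hyp)
                                               Y.¬¬-elim)))
    not-found : ⊢ (Invariant b ⇒ ((c b ≠ 𝟎) ⇒ Invariant (S b)))
    not-found = W.by-cases {h (S b) == 𝟎} found-now still-not-found

  Invariant-[x′≔] : ∀ u → Invariant (var x′) [ x′ ≔ u ] ≡ Invariant u
  Invariant-[x′≔] u = trans (cong₂ (λ p q → Shape p q (Aᵘ 𝟎 [ x′ ≔ u ]) (Aᵘ (S (var x′)) [ x′ ≔ u ]))
                                   c-instance h-instance)
                            (cong₂ (Shape (c u) (h (t u))) (Aᵘ-[x′≔] 𝟎 u)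
                                   (trans (Aᵘ-[x′≔] (S (var x′)) u) (cong (Aᵘ ∘ S) (↦-≡ x′ u))))
    where
    t-instance : t (var x′) ⟦ x′ ↦ u ⟧ ≡ t u
    t-instance = trans (μ-⟦⟧ (x′ ↦ u) (var x′) (λ v v∈ys → ↦-≢ u λ { refl → ∉-otherVars N x′ v∈ys }))
                       (cong t (↦-≡ x′ u))
    c-instance : c (var x′) ⟦ x′ ↦ u ⟧ ≡ c u
    c-instance = cong₂ (λ p q → (p -ᵗ q) ≐ 𝟎) t-instance (↦-≡ x′ u)
    h-instance : h (t (var x′)) ⟦ x′ ↦ u ⟧ ≡ h (t u)
    h-instance = trans (⟦↦⟧-⟦↦⟧ (χ N) x′ (t (var x′)) u) (cong h t-instance)

  invariant : ∀ u → ⊢ Invariant u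
  invariant u = subst ⊢_ (Invariant-[x′≔] u) (inst everywhere (x′ ↦ u))
    where
    I : Fm
    I = Invariant (var x′)
    w : ℕ
    w = fresh (varsF I)
    everywhere : ⊢ I
    everywhere = subst ⊢_ (Invariant-[x′≔] (var x′))
      (ind {A = I} x′ w (∉⇒occurs≡false (varsF I) (fresh-∉ (varsF I)))
           (subst ⊢_ (sym (Invariant-[x′≔] 𝟎)) invariant-zero)
           (subst₂ (λ p q → ⊢ (p ⇒ q)) (sym (Invariant-[x′≔] (var w)))
                   (sym (Invariant-[x′≔] (S (var w))))
                   (invariant-suc (var w))))

  px : Tm ℕ
  px = Pᵗ (var x)

  schema : ⊢ indSchema A x x′
  schema = subst (λ q → ⊢ ((Aᵘ 𝟎 ∧ᶠ q) ⇒ Aᵘ (var x))) (sym (Step-[x′≔] (t px)))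
                 (case-zero-suc T₁ (var x) x=0 x=S)
    where
    T₁ : Theory (λ X → ⊢ ((Aᵘ 𝟎 ∧ᶠ Step (t px)) ⇒ X))
    T₁ = assuming pra (Aᵘ 𝟎 ∧ᶠ Step (t px))
    module U = Rules T₁
    module V = Rules (assuming T₁ (var x == 𝟎))
    T₂ : Theory (λ X → ⊢ ((Aᵘ 𝟎 ∧ᶠ Step (t px)) ⇒ ((var x == S px) ⇒ X)))
    T₂ = assuming T₁ (var x == S px)
    module W = Rules T₂
    module X = Rules (assuming T₂ (c px == 𝟎))
    module Y = Rules (assuming T₂ (c px ≠ 𝟎))
    A₀ : ⊢ ((Aᵘ 𝟎 ∧ᶠ Step (t px)) ⇒ Aᵘ 𝟎)
    A₀ = U.∧-elimˡ (Reasoning.hyp pra)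
    step : ⊢ ((Aᵘ 𝟎 ∧ᶠ Step (t px)) ⇒ Step (t px))
    step = U.∧-elimʳ (Reasoning.hyp pra)
    x=0 : ⊢ ((Aᵘ 𝟎 ∧ᶠ Step (t px)) ⇒ ((var x == 𝟎) ⇒ Aᵘ (var x)))
    x=0 = V.replace-at A x (V.==-sym U.hyp) (U.weaken A₀)
    up : ∀ {H X} → ⊢ X → ⊢ ((Aᵘ 𝟎 ∧ᶠ Step (t px)) ⇒ ((var x == S px) ⇒ (H ⇒ X)))
    up = W.weaken ∘ U.weaken ∘ Reasoning.weaken pra
    refutation-found : ⊢ ((Aᵘ 𝟎 ∧ᶠ Step (t px)) ⇒ ((var x == S px) ⇒ ((c px == 𝟎) ⇒ Aᵘ (var x))))
    refutation-found = X.zero-suc-absurd (X.detach W.hyp (up (∧-elimˡ (invariant px))))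
                                         (X.detach (X.detach (W.weaken (U.weaken step)) X.¬¬-intro)
                                                   (up (unrefuted (t px))))
      where open Reasoning pra
    no-refutation : ⊢ ((Aᵘ 𝟎 ∧ᶠ Step (t px)) ⇒ ((var x == S px) ⇒ ((c px ≠ 𝟎) ⇒ Aᵘ (var x))))
    no-refutation = Y.replace-at A x (Y.==-sym (W.weaken U.hyp))
                                 (Y.detach (W.weaken (U.weaken A₀))
                                           (Y.detach W.hyp (up (∧-elimʳ (invariant px)))))
      where open Reasoning pra
    x=S : ⊢ ((Aᵘ 𝟎 ∧ᶠ Step (t px)) ⇒ ((var x == S px) ⇒ Aᵘ (var x)))
    x=S = W.by-cases {c px == 𝟎} refutation-found no-refutation

-- PRA, PRA* and χPRA*

Ax*-sound : ∀ {A} → Ax* A → ⊢ A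
Ax*-sound (praAx a σ)               = inst (ax a) σ
Ax*-sound (indAx A x x′ _ x′∉A σ)   = inst (InductionSchema.schema A x x′ x′∉A) σ

⊢*⇒⊢ : ∀ {A} → ⊢* A → ⊢ A
⊢*⇒⊢ (ax a)   = Ax*-sound a
⊢*⇒⊢ (mp d e) = mp (⊢*⇒⊢ d) (⊢*⇒⊢ e)

Ax*-[]F : ∀ {A} → Ax* A → (σ : ℕ → Tm ℕ) → Ax* (A [ σ ]F)
Ax*-[]F (praAx {A} a τ) σ =
  subst Ax* (sym ([]F-[]F A τ σ)) (praAx a (τ ⨾ σ))
Ax*-[]F (indAx A x x′ x′≢x x′∉A τ) σ =
  subst Ax* (sym ([]F-[]F (indSchema A x x′) τ σ)) (indAx A x x′ x′≢x x′∉A (τ ⨾ σ))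

⊢*-[]F : ∀ {A} → ⊢* A → (σ : ℕ → Tm ℕ) → ⊢* (A [ σ ]F)
⊢*-[]F (ax a)   σ = ax (Ax*-[]F a σ)
⊢*-[]F (mp d e) σ = mp (⊢*-[]F d σ) (⊢*-[]F e σ)

AxPRA⇒⊢* : ∀ {A} → AxPRA A → ⊢* A
AxPRA⇒⊢* {A} a = subst ⊢*_ ([var]F A) (ax (praAx a var))

pra* : HilbertSystem ⊢*_
pra* = record
  { contraction = λ A → AxPRA⇒⊢* (contr A)
  ; expansion   = λ A B → AxPRA⇒⊢* (weak A B)
  ; permutation = λ A B → AxPRA⇒⊢* (perm A B)
  ; summation   = λ A B C → AxPRA⇒⊢* (assocR A B C)
  ; detach      = mp }

[≔]-absent : ∀ A x (u u′ : Tm ℕ) → occurs x (varsF A) ≡ false → A [ x ≔ u ] ≡ A [ x ≔ u′ ]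
[≔]-absent A x u u′ x∉A = []F-cong A pointwise
  where
  pointwise : ∀ w → w ∈ varsF A → (x ↦ u) w ≡ (x ↦ u′) w
  pointwise w w∈A = trans (↦-≢ u w≢x) (sym (↦-≢ u′ w≢x))
    where
    w≢x : w ≢ x
    w≢x refl = occurs≡false⇒∉ x∉A w∈A

⊢⇒⊢* : ∀ {A} → ⊢ A → ⊢* A
⊢⇒⊢* (ax a)     = AxPRA⇒⊢* a
⊢⇒⊢* (inst d σ) = ⊢*-[]F (⊢⇒⊢* d) σ
⊢⇒⊢* (mp d e)   = mp (⊢⇒⊢* d) (⊢⇒⊢* e)
⊢⇒⊢* (ind {A} x x′ x′∉A base step) with x′ ≟ x
... | yes refl = subst ⊢*_ ([≔]-absent A x 𝟎 (var x) x′∉A) (⊢⇒⊢* base)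
... | no x′≢x  =
  mp (Propositional.∧-intro pra* (⊢⇒⊢* base) (⊢*-[]F (⊢⇒⊢* step) (x′ ↦ μ (~ B) x′ (Pᵗ (var x)))))
     (subst ⊢*_ ([var]F _) (ax (indAx A x x′ x′≢x x′∉A var)))
  where
  B : Fm
  B = (A [ x ≔ var x′ ]) ⇒ (A [ x ≔ S (var x′) ])

ground : ℕ → Tm ℕ
ground _ = 𝟎

varsT-⟦ground⟧  : ∀ (t : Tm ℕ) → ClosedT (t ⟦ ground ⟧)
varsT*-⟦ground⟧ : ∀ {n} (ts : Vec (Tm ℕ) n) → varsT* (ts ⟦ ground ⟧*) ≡ []
varsT-⟦ground⟧ (var v)    = refl
varsT-⟦ground⟧ (app f ts) = varsT*-⟦ground⟧ ts
varsT*-⟦ground⟧ []       = refl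
varsT*-⟦ground⟧ (t ∷ ts) rewrite varsT-⟦ground⟧ t = varsT*-⟦ground⟧ ts

varsF-[ground]F : ∀ A → ClosedF (A [ ground ]F)
varsF-[ground]F (a == b) rewrite varsT-⟦ground⟧ a = varsT-⟦ground⟧ b
varsF-[ground]F (~ A)    = varsF-[ground]F A
varsF-[ground]F (A ∨ B)  rewrite varsF-[ground]F A = varsF-[ground]F B

⟦⟧-closed : ∀ {t} → ClosedT t → (σ : ℕ → Tm ℕ) → t ⟦ σ ⟧ ≡ t
⟦⟧-closed {t} closed σ =
  trans (⟦⟧-cong t (λ v v∈t → case subst (v ∈_) closed v∈t of λ ())) (⟦var⟧ t)

[]F-closed : ∀ {A} → ClosedF A → (σ : ℕ → Tm ℕ) → A [ σ ]F ≡ A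
[]F-closed {A} closed σ =
  trans ([]F-cong A (λ v v∈A → case subst (v ∈_) closed v∈A of λ ())) ([var]F A)

ground-⊢* : ∀ {A} → ⊢* A → Σ (⊢* (A [ ground ]F)) VarFree*
ground-⊢* {A} (ax a)   = ax (Ax*-[]F a ground) , varsF-[ground]F A
ground-⊢* {A} (mp d e) with ground-⊢* d | ground-⊢* e
... | d′ , d′-free | e′ , e′-free = mp d′ e′ , varsF-[ground]F A , d′-free , e′-free

closed-⊢*-VarFree : ∀ A → ClosedF A → ⊢* A → Σ (⊢* A) VarFree*
closed-⊢*-VarFree A closed d =
  subst (λ B → Σ (⊢* B) VarFree*) ([]F-closed closed ground) (ground-⊢* d)

χ-IsχFm : ∀ A → IsχFm (χ A)
χ-IsχFm (a == b) = χeq a b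
χ-IsχFm (~ A)    = χneg (χ-IsχFm A)
χ-IsχFm (A ∨ B)  = χor (χ-IsχFm A) (χ-IsχFm B)

IsχFm-⟦⟧ : ∀ {α} → IsχFm α → (σ : ℕ → Tm ℕ) → IsχFm (α ⟦ σ ⟧)
IsχFm-⟦⟧ (χeq a b)   σ = χeq (a ⟦ σ ⟧) (b ⟦ σ ⟧)
IsχFm-⟦⟧ (χneg α)    σ = χneg (IsχFm-⟦⟧ α σ)
IsχFm-⟦⟧ (χor α β)   σ = χor (IsχFm-⟦⟧ α σ) (IsχFm-⟦⟧ β σ)

χ-onto : ∀ {α} → IsχFm α → Σ Fm λ A → χ A ≡ α
χ-onto (χeq a b) = (a == b) , refl
χ-onto (χneg α) with χ-onto α
... | A , refl = ~ A , refl
χ-onto (χor α β) with χ-onto α | χ-onto β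
... | A , refl | B , refl = A ∨ B , refl

C-injective : ∀ {x y z x′ y′ z′ : Tm ℕ} → C x y z ≡ C x′ y′ z′ → x ≡ x′ × y ≡ y′ × z ≡ z′
C-injective refl = refl , refl , refl

χ-injective : ∀ A B → χ A ≡ χ B → A ≡ B
χ-injective (a == b) (a′ == b′) refl = refl
χ-injective (~ A)    (~ B)      eq   = cong ~_ (χ-injective A B (proj₁ (C-injective eq)))
χ-injective (A ∨ B)  (A′ ∨ B′)  eq   =
  cong₂ _∨_ (χ-injective A A′ (proj₁ (C-injective eq)))
            (χ-injective B B′ (proj₁ (C-injective (proj₂ (proj₂ (C-injective eq))))))
χ-injective (a == b) (~ B)      ()
χ-injective (a == b) (B ∨ B′)   ()
χ-injective (~ A)    (b == b′)  ()
χ-injective (~ A)    (B ∨ B′)   ()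
χ-injective (A ∨ A′) (b == b′)  ()
χ-injective (A ∨ A′) (~ B)      ()

⊢*⇒⊢χ* : ∀ {A} → ⊢* A → ⊢χ* χ A
⊢*⇒⊢χ* (ax a)           = ax a
⊢*⇒⊢χ* (mp {A} {B} d e) = mp (χ-IsχFm A) (χ-IsχFm B) (⊢*⇒⊢χ* d) (⊢*⇒⊢χ* e)

⊢χ*⇒⊢* : ∀ {α} → ⊢χ* α → ∀ A → α ≡ χ A → ⊢* A
⊢χ*⇒⊢* (ax {B} a)       A eq = subst ⊢*_ (χ-injective B A eq) (ax a)
⊢χ*⇒⊢* (mp α _ d e)     A eq with χ-onto α
... | B , refl = mp (⊢χ*⇒⊢* d B refl) (⊢χ*⇒⊢* e (B ⇒ A) (cong (χ B →̇_) eq))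

ground-⊢χ* : ∀ {α} → ⊢χ* α → Σ (⊢χ* (α ⟦ ground ⟧)) VarFreeχ
ground-⊢χ* (ax {A} a) =
  subst (λ β → Σ (⊢χ* β) VarFreeχ) (χ-[]F A ground)
        (ax (Ax*-[]F a ground) , subst ClosedT (sym (χ-[]F A ground)) (varsT-⟦ground⟧ (χ A)))
ground-⊢χ* {β} (mp α β-χ d e) with ground-⊢χ* d | ground-⊢χ* e
... | d′ , d′-free | e′ , e′-free =
  mp (IsχFm-⟦⟧ α ground) (IsχFm-⟦⟧ β-χ ground) d′ e′ , varsT-⟦ground⟧ β , d′-free , e′-free

closed-⊢χ*-VarFree : ∀ α → ClosedT α → ⊢χ* α → Σ (⊢χ* α) VarFreeχ
closed-⊢χ*-VarFree α closed d =
  subst (λ β → Σ (⊢χ* β) VarFreeχ) (⟦⟧-closed closed ground) (ground-⊢χ* d)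

proposition5 : ((A : Fm) → ((⊢ A) → (⊢* A)) × ((⊢* A) → (⊢ A)))
    × ((A : Fm) → ClosedF A → (⊢* A) → Σ (⊢* A) VarFree*)
    × ((A : Fm) → ((⊢* A) → (⊢χ* χ A)) × ((⊢χ* χ A) → (⊢* A)))
    × ((α : Tm ℕ) → IsχFm α → ClosedT α → (⊢χ* α) → Σ (⊢χ* α) VarFreeχ)
proposition5 = (λ A → ⊢⇒⊢* , ⊢*⇒⊢)
             , closed-⊢*-VarFree
             , (λ A → ⊢*⇒⊢χ* , λ d → ⊢χ*⇒⊢* d A refl)
             , (λ α _ → closed-⊢χ*-VarFree α)
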